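{- Let $n\ge1$ and let $i,j,k$ be nonnegative integers with $\max\{i,j\}\le k\le\min\{i+j,n\}$; set $r:=i+j-k$. Regard $C^k_{i,j}$ as a polynomial in $\beta_1,\dots,\beta_n$. Then \[ \operatorname{Supp}(C^k_{i,j})=Q^k_{i,j}\cap\mathbb{Z}^n, \] where \[ Q^k_{i,j}=\Bigl\{x\in\mathbb{R}^n_{\ge0}:\ \sum_{m=1}^nx_m=r,\ \ \sum_{m=1}^{\ell}x_m\le\ell\ \text{for }1\le\ell\le i,\ \ x_m=0\ \text{for }m>k\Bigr\}. \] Consequently $C^k_{i,j}$ has saturated Newton polytope.
   Context: Let $T\subset \mathrm{GL}_{n+1}$ be the diagonal torus acting on $\mathbb{P}^n$, with $H_T^*(\mathrm{pt})=\mathbb{Z}[t_1,\dots,t_{n+1}]$. For $0\le k\le n$ let $\sigma_k=[X_k]_T\in H_T^*(\mathbb{P}^n)$ be the equivariant class of $X_k=\{x_0=\dots=x_{k-1}=0\}$; with $\zeta=c_1^T(\mathcal{O}(1))$ one has $\sigma_k=\prod_{m=1}^k(\zeta+t_m)$. Structure constants $C^k_{i,j}\in H_T^*(\mathrm{pt})$ are defined by $\sigma_i\sigma_j=\sum_kC^k_{i,j}\sigma_k$. Set $\beta_m=t_m-t_{m+1}$; $C^k_{i,j}$ is a polynomial in the $\beta_m$. $\operatorname{Supp}$ of a polynomial in $\beta_1,\dots,\beta_n$ is the set of exponent vectors in $\mathbb{Z}^n_{\ge0}$ of monomials appearing with nonzero coefficient. A polynomial has saturated Newton polytope (SNP) if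 every lattice point of the convex hull of its support lies in its support. -}

module Defs where

open import Data.Nat as ℕ using (ℕ; zero; suc; _∸_)
open import Data.Integer as ℤ using (ℤ; +_; 0ℤ)
open import Data.Rational as ℚ using (ℚ; 0ℚ; 1ℚ)
open import Data.Fin using (Fin; zero; suc)
open import Data.List using (List; []; _∷_; map; upTo; foldr)
open import Data.List.Relation.Unary.All using (All)
open import Data.Product using (_×_; _,_; ∃; proj₁; proj₂)
open import Relation.Binary.PropositionalEquality using (_≡_; _≢_)
open import Function using (_∘_)

-- Polynomials over ℤ in n variables, as dense nested coefficient lists.
-- Poly (suc n) = polynomials in variable 0 with coefficients in Poly n
-- (variables 1..n).  Equality is coefficientwise (_≈P_).

Poly : ℕ → Set
Poly zero    = ℤ
Poly (suc n) = List (Poly n)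

zeroP : ∀ {n} → Poly n
zeroP {zero}  = 0ℤ
zeroP {suc n} = []

constP : ∀ {n} → ℤ → Poly n
constP {zero}  a = a
constP {suc n} a = constP a ∷ []

oneP : ∀ {n} → Poly n
oneP = constP (+ 1)

ι : ∀ {n} → Poly n → Poly (suc n)
ι p = p ∷ []

infixl 6 _⊕_
infixl 7 _⊗_

_⊕_ : ∀ {n} → Poly n → Poly n → Poly n
_⊕_ {zero}  a b = a ℤ.+ b
_⊕_ {suc n} [] q = q
_⊕_ {suc n} (p ∷ ps) [] = p ∷ ps
_⊕_ {suc n} (p ∷ ps) (q ∷ qs) = (p ⊕ q) ∷ (ps ⊕ qs)

_⊗_ : ∀ {n} → Poly n → Poly n → Poly n
_⊗_ {zero}  a b = a ℤ.* b
_⊗_ {suc n} [] q = []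
_⊗_ {suc n} (p ∷ ps) q = map (p ⊗_) q ⊕ (zeroP ∷ (ps ⊗ q))

sumP : ∀ {n} → List (Poly n) → Poly n
sumP = foldr _⊕_ zeroP

prodP : ∀ {n} → List (Poly n) → Poly n
prodP = foldr _⊗_ oneP

-- the variable with (0-based) index l; zero if l ≥ n
varN : ∀ {n} → ℕ → Poly n
varN {zero}  l       = 0ℤ
varN {suc n} zero    = zeroP ∷ oneP ∷ []
varN {suc n} (suc l) = ι (varN l)

lookupD : ∀ {A : Set} → A → List A → ℕ → A
lookupD d []       _       = d
lookupD d (x ∷ xs) zero    = x
lookupD d (x ∷ xs) (suc m) = lookupD d xs m

coeff : ∀ {n} → Poly n → (Fin n → ℕ) → ℤ
coeff {zero}  a e = a
coeff {suc n} p e = coeff (lookupD zeroP p (e zero)) (e ∘ suc)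

infix 4 _≈P_
_≈P_ : ∀ {n} → Poly n → Poly n → Set
p ≈P q = ∀ e → coeff p e ≡ coeff q e

Supp : ∀ {n} → Poly n → (Fin n → ℕ) → Set
Supp p x = coeff p x ≢ 0ℤ

-- Equivariant setup.  Poly n = ℤ[β₁,…,βₙ] (β_m is variable m-1).
-- We normalise t_{n+1} = 0, so t_m = β_m + … + β_n  (β_m = t_m - t_{m+1}).

βP : ∀ {n} → ℕ → Poly n
βP zero    = zeroP
βP (suc l) = varN l

tP : (n : ℕ) → ℕ → Poly n
tP n m = sumP (map (λ d → βP (m ℕ.+ d)) (upTo (suc n ∸ m)))

-- H_T^*-side polynomials: Poly (suc n) = ℤ[β][ζ], variable 0 is ζ.
-- ζ + t_m
ζ+t : (n : ℕ) → ℕ → Poly (suc n)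
ζ+t n m = tP n m ∷ oneP ∷ []

σ : (n : ℕ) → ℕ → Poly (suc n)
σ n k = prodP (map (λ d → ζ+t n (suc d)) (upTo k))

expand : (n : ℕ) → (ℕ → Poly n) → Poly (suc n)
expand n c = sumP (map (λ k → ι (c k) ⊗ σ n k) (upTo (suc n)))

-- c represents the structure constants C^k_{i,j} (k = 0..n) :
-- σ_i σ_j = Σ_k c_k σ_k in H_T^*(P^n) = ℤ[β][ζ] / (σ_{n+1}),
-- i.e. the difference is a multiple q · σ_{n+1}.
IsStructConst : (n i j : ℕ) → (ℕ → Poly n) → Set
IsStructConst n i j c =
  ∃ λ (q : Poly (suc n)) → σ n i ⊗ σ n j ≈P expand n c ⊕ q ⊗ σ n (suc n)

-- psum x ℓ = x_1 + … + x_ℓ  (x_m stored at index m-1)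
psum : ∀ {n} → (Fin n → ℕ) → ℕ → ℕ
psum {zero}  x _       = 0
psum {suc n} x zero    = 0
psum {suc n} x (suc ℓ) = x zero ℕ.+ psum (x ∘ suc) ℓ

toℕFin : ∀ {n} → Fin n → ℕ
toℕFin zero    = 0
toℕFin (suc m) = suc (toℕFin m)

-- lattice point x ∈ ℤⁿ_{≥0} (so x ∈ ℕⁿ) lies in Q^k_{i,j} with r = i+j-k
InQ : (n i k r : ℕ) → (Fin n → ℕ) → Set
InQ n i k r x =
    (psum x n ≡ r)
  × (∀ ℓ → 1 ℕ.≤ ℓ → ℓ ℕ.≤ i → psum x ℓ ℕ.≤ ℓ)
  × (∀ (m : Fin n) → k ℕ.≤ toℕFin m → x m ≡ 0)   -- x_{m+1} = 0 when m+1 > k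

toℚ : ℕ → ℚ
toℚ a = (+ a) ℚ./ 1

-- x ∈ ℤⁿ lies in the (real) convex hull of the support of p:
-- a finite convex combination, with nonnegative rational weights summing to 1,
-- of support points equals x.  (Rational weights suffice for rational points.)
InConvHullSupp : ∀ {n} → Poly n → (Fin n → ℤ) → Set
InConvHullSupp {n} p x =
  ∃ λ (pts : List (ℚ × (Fin n → ℕ))) →
      All (λ wy → (0ℚ ℚ.≤ proj₁ wy) × Supp p (proj₂ wy)) pts
    × (foldr (λ wy s → proj₁ wy ℚ.+ s) 0ℚ pts ≡ 1ℚ)
    × (∀ m → foldr (λ wy s → proj₁ wy ℚ.* toℚ (proj₂ wy m) ℚ.+ s) 0ℚ pts
             ≡ (x m) ℚ./ 1)

SNP : ∀ {n} → Poly n → Set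
SNP {n} p = ∀ (x : Fin n → ℤ) → InConvHullSupp p x →
  ∃ λ (y : Fin n → ℕ) → (∀ m → x m ≡ + (y m)) × Supp p y

{-# OPTIONS --safe #-}
-- Since σ_{j+1} = σ_j (ζ + t_{j+1}) and (ζ + t_{j+1}) σ_k = σ_{k+1} + (β_{j+1} + ⋯ + β_k) σ_k,
-- the structure constants satisfy C^k_{i,0} = δ_{ik} and
--   C^k_{i,j+1} = C^{k-1}_{i,j} + (β_{j+1} + ⋯ + β_k) C^k_{i,j},
-- and they are determined by this recursion because σ_k is monic of degree k in ζ. All the
-- polynomials involved have nonnegative coefficients, so supports add up without cancellation:
-- a monomial of C^k_{i,j+1} is a monomial of C^{k-1}_{i,j}, or one of C^k_{i,j} times some β_v
-- with j < v ≤ k. This is also how the lattice points of Q^k_{i,j+1} arise from those for j.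
-- The support is thus the set of lattice points of a polytope cut out by linear constraints,
-- and such a set is saturated.

module Submission where

open import Defs
open import Algebra.Bundles using (AbelianGroup; CommutativeMonoid; CommutativeRing; RawGroup)
import Algebra.Consequences.Setoid as Consequences
import Algebra.Construct.Pointwise as Pointwise
open import Algebra.Morphism.Structures using (IsGroupMonomorphism)
import Algebra.Morphism.GroupMonomorphism as GroupMonomorphism
import Algebra.Properties.CommutativeSemigroup as CommSemigroupProperties
import Algebra.Properties.Ring
open import Algebra.Structures using (IsAbelianGroup; IsCommutativeRing)
open import Data.Bool using (if_then_else_)
open import Data.Empty using (⊥; ⊥-elim)
open import Data.Fin using (Fin; zero; suc; toℕ; fromℕ<)
import Data.Fin.Properties as Fin
open import Data.Integer as ℤ using (ℤ; 0ℤ)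
import Data.Integer.Properties as ℤ
open import Data.List using (List; []; _∷_; map; foldr; applyUpTo; upTo)
open import Data.List.Properties using (map-applyUpTo)
open import Data.List.Relation.Unary.All as All using (All; []; _∷_)
open import Data.Nat as ℕ using (ℕ; zero; suc; pred; _∸_; _≤_; _<_; _≟_; _≤?_; _<?_; s≤s; z≤n)
import Data.Nat.Coprimality as Coprimality
import Data.Nat.Properties as ℕ
open import Data.Product using (∃; _×_; _,_; proj₁; proj₂)
open import Data.Rational as ℚ using (ℚ; 0ℚ; mkℚ)
import Data.Rational.Properties as ℚ
open import Data.Sum using (_⊎_; inj₁; inj₂; [_,_])
open import Data.Sum.Function.Propositional using (_⊎-⇔_)
open import Data.Vec.Functional using (head; tail; updateAt) renaming (_∷_ to _∷ᶠ_)
open import Data.Vec.Functional.Properties using (updateAt-id; updateAt-minimal; updateAt-updateAt-local)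
open import Function using (_∘_; id; _⇔_; mk⇔; Equivalence; case_of_)
import Function.Properties.Equivalence as ⇔
open import Level using (0ℓ)
open import Relation.Binary.PropositionalEquality as ≡ using (_≡_; _≢_; _≗_; cong; cong₂; subst₂)
import Relation.Binary.Reasoning.Setoid as ≈-Reasoning
open import Relation.Nullary using (¬_; does; yes; no)
open import Relation.Nullary.Decidable using (dec-true; dec-false; _×-dec_)

-- The ring of polynomials

infix 4 _≋_

-- A record rather than Defs._≈P_ itself, so that p and q can be inferred from p ≋ q.
record _≋_ {n : ℕ} (p q : Poly n) : Set where
  constructor mk≋
  field coeff-≡ : p ≈P q
open _≋_ public

negP : ∀ {n} → Poly n → Poly n
negP {zero}  = ℤ.-_
negP {suc n} = map negP

coeff₀ : ∀ {n} → Poly (suc n) → ℕ → Poly n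
coeff₀ = lookupD zeroP

coeff₀-cong : ∀ {n} {p q : Poly (suc n)} → p ≋ q → ∀ d → coeff₀ p d ≋ coeff₀ q d
coeff₀-cong (mk≋ p≈q) d = mk≋ λ e → p≈q (d ∷ᶠ e)

coeff₀-ext : ∀ {n} {p q : Poly (suc n)} → (∀ d → coeff₀ p d ≋ coeff₀ q d) → p ≋ q
coeff₀-ext p≈q = mk≋ λ e → coeff-≡ (p≈q (head e)) (tail e)

∷-cong : ∀ {n} {a b : Poly n} {as bs : Poly (suc n)} → a ≋ b → as ≋ bs → a ∷ as ≋ b ∷ bs
∷-cong a≋b as≋bs = coeff₀-ext λ { zero → a≋b ; (suc d) → coeff₀-cong as≋bs d }

coeff-zeroP : ∀ {n} e → coeff (zeroP {n}) e ≡ 0ℤ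
coeff-zeroP {zero}  e = ≡.refl
coeff-zeroP {suc n} e = coeff-zeroP (tail e)

coeff-⊕ : ∀ {n} (p q : Poly n) e → coeff (p ⊕ q) e ≡ coeff p e ℤ.+ coeff q e
coeff-⊕ {zero}  p q e = ≡.refl
coeff-⊕ {suc n} [] q e =
  ≡.sym (≡.trans (cong (λ z → z ℤ.+ coeff q e) (coeff-zeroP (tail e))) (ℤ.+-identityˡ _))
coeff-⊕ {suc n} (a ∷ as) [] e =
  ≡.sym (≡.trans (cong (λ z → coeff (a ∷ as) e ℤ.+ z) (coeff-zeroP (tail e))) (ℤ.+-identityʳ _))
coeff-⊕ {suc n} (a ∷ as) (b ∷ bs) e with head e
... | zero  = coeff-⊕ a b (tail e)
... | suc d = coeff-⊕ as bs (d ∷ᶠ tail e)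

coeff-negP : ∀ {n} (p : Poly n) e → coeff (negP p) e ≡ ℤ.- coeff p e
coeff-negP {zero}  p        e = ≡.refl
coeff-negP {suc n} []       e =
  ≡.trans (coeff-zeroP (tail e)) (cong ℤ.-_ (≡.sym (coeff-zeroP (tail e))))
coeff-negP {suc n} (a ∷ as) e with head e
... | zero  = coeff-negP a (tail e)
... | suc d = coeff-negP as (d ∷ᶠ tail e)

coeff₀-⊕ : ∀ {n} (p q : Poly (suc n)) d → coeff₀ (p ⊕ q) d ≋ coeff₀ p d ⊕ coeff₀ q d
coeff₀-⊕ p q d = mk≋ λ e →
  ≡.trans (coeff-⊕ p q (d ∷ᶠ e)) (≡.sym (coeff-⊕ (coeff₀ p d) (coeff₀ q d) e))

-- coeff embeds (Poly n, ⊕) into the pointwise group of ℤ-valued functions on exponents.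
⊕-isAbelianGroup : ∀ n → IsAbelianGroup (_≋_ {n}) _⊕_ zeroP negP
⊕-isAbelianGroup n = GroupMonomorphism.isAbelianGroup coeff-isGroupMonomorphism
  (AbelianGroup.isAbelianGroup coefficientFunctions)
  where
  coefficientFunctions = Pointwise.abelianGroup (Fin n → ℕ) ℤ.+-0-abelianGroup
  poly-rawGroup : RawGroup _ _
  poly-rawGroup = record { _≈_ = _≋_ ; _∙_ = _⊕_ ; ε = zeroP ; _⁻¹ = negP }
  coeff-isGroupMonomorphism :
    IsGroupMonomorphism poly-rawGroup (AbelianGroup.rawGroup coefficientFunctions) coeff
  coeff-isGroupMonomorphism = record
    { isGroupHomomorphism = record
      { isMonoidHomomorphism = record
        { isMagmaHomomorphism = record
          { isRelHomomorphism = record { cong = coeff-≡ }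
          ; homo = coeff-⊕ }
        ; ε-homo = coeff-zeroP }
      ; ⁻¹-homo = coeff-negP }
    ; injective = mk≋ }

⊕-abelianGroup : ℕ → AbelianGroup 0ℓ 0ℓ
⊕-abelianGroup n = record { isAbelianGroup = ⊕-isAbelianGroup n }

module _ {n : ℕ} where
  open import Algebra.Definitions (_≋_ {n})
  open Consequences (IsAbelianGroup.setoid (⊕-isAbelianGroup n))

  isCommutativeRingˡ : Congruent₂ _⊗_ → Associative _⊗_ → Commutative _⊗_ →
    LeftIdentity oneP _⊗_ → _⊗_ DistributesOverˡ _⊕_ →
    IsCommutativeRing _≋_ _⊕_ _⊗_ negP zeroP oneP
  isCommutativeRingˡ ⊗-cong ⊗-assoc ⊗-comm ⊗-identityˡ ⊗-distribˡ = record
    { isRing = record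
      { +-isAbelianGroup = ⊕-isAbelianGroup n
      ; *-cong     = ⊗-cong
      ; *-assoc    = ⊗-assoc
      ; *-identity = comm∧idˡ⇒id ⊗-comm ⊗-identityˡ
      ; distrib    = comm∧distrˡ⇒distr (IsAbelianGroup.∙-cong (⊕-isAbelianGroup n)) ⊗-comm ⊗-distribˡ
      }
    ; *-comm = ⊗-comm
    }

isCommutativeRing₀ : IsCommutativeRing (_≋_ {0}) _⊕_ _⊗_ negP zeroP oneP
isCommutativeRing₀ = isCommutativeRingˡ
  (λ a≋b c≋d → lift (cong₂ ℤ._*_ (unlift a≋b) (unlift c≋d)))
  (λ a b c → lift (ℤ.*-assoc a b c))
  (λ a b → lift (ℤ.*-comm a b))
  (λ a → lift (ℤ.*-identityˡ a))
  (λ a b c → lift (ℤ.*-distribˡ-+ a b c))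
  where
  lift : {a b : ℤ} → a ≡ b → a ≋ b
  lift a≡b = mk≋ λ _ → a≡b
  unlift : {a b : ℤ} → a ≋ b → a ≡ b
  unlift a≋b = coeff-≡ a≋b (λ ())

module AdjoinVariable {n : ℕ} (isCR : IsCommutativeRing (_≋_ {n}) _⊕_ _⊗_ negP zeroP oneP) where
  private
    module R = IsCommutativeRing isCR
    module G = IsAbelianGroup (⊕-isAbelianGroup (suc n))
  open CommSemigroupProperties (AbelianGroup.commutativeSemigroup (⊕-abelianGroup (suc n)))
    using (interchange)
  open ≈-Reasoning G.setoid

  ⊕-congˡ : ∀ (p : Poly (suc n)) {q q'} → q ≋ q' → p ⊕ q ≋ p ⊕ q'
  ⊕-congˡ p = G.∙-congˡ {p}

  ⊕-congʳ : ∀ (q : Poly (suc n)) {p p'} → p ≋ p' → p ⊕ q ≋ p' ⊕ q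
  ⊕-congʳ q = G.∙-congʳ {q}

  scale : Poly n → Poly (suc n) → Poly (suc n)
  scale u = map (u ⊗_)

  -- multiplication by the variable x₀; note that (a ∷ as) ⊗ q = scale a q ⊕ shift (as ⊗ q)
  shift : Poly (suc n) → Poly (suc n)
  shift = zeroP ∷_

  coeff₀-scale : ∀ u (q : Poly (suc n)) d → coeff₀ (scale u q) d ≋ u ⊗ coeff₀ q d
  coeff₀-scale u []       d       = R.sym (R.zeroʳ u)
  coeff₀-scale u (b ∷ bs) zero    = R.refl
  coeff₀-scale u (b ∷ bs) (suc d) = coeff₀-scale u bs d

  scale-cong : ∀ {u u' q q'} → u ≋ u' → q ≋ q' → scale u q ≋ scale u' q'
  scale-cong {u} {u'} {q} {q'} u≋u' q≋q' = coeff₀-ext λ d →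
    R.trans (coeff₀-scale u q d)
      (R.trans (R.*-cong u≋u' (coeff₀-cong q≋q' d)) (R.sym (coeff₀-scale u' q' d)))

  scale-congˡ : ∀ {u u'} (q : Poly (suc n)) → u ≋ u' → scale u q ≋ scale u' q
  scale-congˡ q u≋u' = scale-cong u≋u' (G.refl {q})

  scale-zeroˡ : ∀ (q : Poly (suc n)) → scale zeroP q ≋ []
  scale-zeroˡ q = coeff₀-ext λ d → R.trans (coeff₀-scale zeroP q d) (R.zeroˡ _)

  scale-identityˡ : ∀ (q : Poly (suc n)) → scale oneP q ≋ q
  scale-identityˡ q = coeff₀-ext λ d → R.trans (coeff₀-scale oneP q d) (R.*-identityˡ _)

  scale-assoc : ∀ u v (q : Poly (suc n)) → scale u (scale v q) ≋ scale (u ⊗ v) q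
  scale-assoc u v []       = G.refl
  scale-assoc u v (b ∷ bs) = ∷-cong (R.sym (R.*-assoc u v b)) (scale-assoc u v bs)

  scale-distribˡ : ∀ u (q r : Poly (suc n)) → scale u (q ⊕ r) ≋ scale u q ⊕ scale u r
  scale-distribˡ u []       r        = G.refl
  scale-distribˡ u (b ∷ bs) []       = G.refl
  scale-distribˡ u (b ∷ bs) (c ∷ cs) = ∷-cong (R.distribˡ u b c) (scale-distribˡ u bs cs)

  shift-[] : shift [] ≋ []
  shift-[] = coeff₀-ext λ { zero → R.refl ; (suc d) → R.refl }

  shift-cong : ∀ {p q : Poly (suc n)} → p ≋ q → shift p ≋ shift q
  shift-cong = ∷-cong R.refl

  shift-⊕ : ∀ (p q : Poly (suc n)) → shift (p ⊕ q) ≋ shift p ⊕ shift q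
  shift-⊕ p q = ∷-cong (R.sym (R.+-identityˡ zeroP)) G.refl

  scale-shift : ∀ u (p : Poly (suc n)) → scale u (shift p) ≋ shift (scale u p)
  scale-shift u p = ∷-cong (R.zeroʳ u) G.refl

  ∷-as-⊕ : ∀ a (as : Poly (suc n)) → a ∷ as ≋ (a ∷ []) ⊕ shift as
  ∷-as-⊕ a as = ∷-cong (R.sym (R.+-identityʳ a)) G.refl

  ι-⊗ : ∀ a (p : Poly (suc n)) → ι a ⊗ p ≋ scale a p
  ι-⊗ a p = G.trans (⊕-congˡ (scale a p) shift-[]) (G.identityʳ (scale a p))

  coeff₀-ι-⊗ : ∀ u (p : Poly (suc n)) d → coeff₀ (ι u ⊗ p) d ≋ u ⊗ coeff₀ p d
  coeff₀-ι-⊗ u p d = R.trans (coeff₀-cong (ι-⊗ u p) d) (coeff₀-scale u p d)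

  ⊗-annihilatedˡ : ∀ (p q : Poly (suc n)) → p ≋ [] → p ⊗ q ≋ []
  ⊗-annihilatedˡ []       q p≋[] = G.refl
  ⊗-annihilatedˡ (a ∷ as) q p≋[] = begin
    scale a q ⊕ shift (as ⊗ q)  ≈⟨ G.∙-cong (scale-congˡ q (coeff₀-cong p≋[] 0)) (shift-cong as⊗q≋[]) ⟩
    scale zeroP q ⊕ shift []    ≈⟨ G.∙-cong (scale-zeroˡ q) shift-[] ⟩
    []                          ∎
    where as⊗q≋[] = ⊗-annihilatedˡ as q (coeff₀-ext λ d → coeff₀-cong p≋[] (suc d))

  ⊗-congˡ : ∀ {p p' : Poly (suc n)} q → p ≋ p' → p ⊗ q ≋ p' ⊗ q
  ⊗-congˡ {[]}     {p'}     q p≋p' = G.sym (⊗-annihilatedˡ p' q (G.sym p≋p'))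
  ⊗-congˡ {a ∷ as} {[]}     q p≋p' = ⊗-annihilatedˡ (a ∷ as) q p≋p'
  ⊗-congˡ {a ∷ as} {b ∷ bs} q p≋p' = G.∙-cong
    (scale-congˡ q (coeff₀-cong p≋p' 0))
    (shift-cong (⊗-congˡ {as} {bs} q (coeff₀-ext λ d → coeff₀-cong p≋p' (suc d))))

  ⊗-congʳ : ∀ (p : Poly (suc n)) {q q'} → q ≋ q' → p ⊗ q ≋ p ⊗ q'
  ⊗-congʳ []       q≋q' = G.refl
  ⊗-congʳ (a ∷ as) q≋q' = G.∙-cong (scale-cong R.refl q≋q') (shift-cong (⊗-congʳ as q≋q'))

  ⊗-cong : ∀ {p p' q q' : Poly (suc n)} → p ≋ p' → q ≋ q' → p ⊗ q ≋ p' ⊗ q'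
  ⊗-cong {p' = p'} {q} p≋p' q≋q' = G.trans (⊗-congˡ q p≋p') (⊗-congʳ p' q≋q')

  ⊗-zeroʳ : ∀ (p : Poly (suc n)) → p ⊗ [] ≋ []
  ⊗-zeroʳ []       = G.refl
  ⊗-zeroʳ (a ∷ as) = G.trans (shift-cong (⊗-zeroʳ as)) shift-[]

  ⊗-distribˡ : ∀ (p q r : Poly (suc n)) → p ⊗ (q ⊕ r) ≋ p ⊗ q ⊕ p ⊗ r
  ⊗-distribˡ []       q r = G.refl
  ⊗-distribˡ (a ∷ as) q r = begin
    scale a (q ⊕ r) ⊕ shift (as ⊗ (q ⊕ r))
      ≈⟨ G.∙-cong (scale-distribˡ a q r)
                  (G.trans (shift-cong (⊗-distribˡ as q r)) (shift-⊕ (as ⊗ q) (as ⊗ r))) ⟩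
    (scale a q ⊕ scale a r) ⊕ (shift (as ⊗ q) ⊕ shift (as ⊗ r))
      ≈⟨ interchange (scale a q) (scale a r) (shift (as ⊗ q)) (shift (as ⊗ r)) ⟩
    (scale a q ⊕ shift (as ⊗ q)) ⊕ (scale a r ⊕ shift (as ⊗ r))
      ∎

  ⊗-singletonʳ : ∀ (q : Poly (suc n)) a → q ⊗ (a ∷ []) ≋ scale a q
  ⊗-singletonʳ []       a = G.refl
  ⊗-singletonʳ (b ∷ bs) a = ∷-cong (R.trans (R.+-identityʳ _) (R.*-comm b a)) (⊗-singletonʳ bs a)

  ⊗-shiftʳ : ∀ (p q : Poly (suc n)) → p ⊗ shift q ≋ shift (p ⊗ q)
  ⊗-shiftʳ []       q = G.sym shift-[]
  ⊗-shiftʳ (a ∷ as) q = begin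
    scale a (shift q) ⊕ shift (as ⊗ shift q)      ≈⟨ G.∙-cong (scale-shift a q) (shift-cong (⊗-shiftʳ as q)) ⟩
    shift (scale a q) ⊕ shift (shift (as ⊗ q))    ≈⟨ shift-⊕ (scale a q) (shift (as ⊗ q)) ⟨
    shift (scale a q ⊕ shift (as ⊗ q))            ∎

  ⊗-comm : ∀ (p q : Poly (suc n)) → p ⊗ q ≋ q ⊗ p
  ⊗-comm []       q = G.sym (⊗-zeroʳ q)
  ⊗-comm (a ∷ as) q = begin
    scale a q ⊕ shift (as ⊗ q)        ≈⟨ G.∙-cong (G.sym (⊗-singletonʳ q a)) (shift-cong (⊗-comm as q)) ⟩
    q ⊗ (a ∷ []) ⊕ shift (q ⊗ as)     ≈⟨ ⊕-congˡ (q ⊗ (a ∷ [])) (⊗-shiftʳ q as) ⟨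
    q ⊗ (a ∷ []) ⊕ q ⊗ shift as       ≈⟨ ⊗-distribˡ q (a ∷ []) (shift as) ⟨
    q ⊗ ((a ∷ []) ⊕ shift as)         ≈⟨ ⊗-congʳ q (∷-as-⊕ a as) ⟨
    q ⊗ (a ∷ as)                      ∎

  ⊗-distribʳ : ∀ (r p q : Poly (suc n)) → (p ⊕ q) ⊗ r ≋ p ⊗ r ⊕ q ⊗ r
  ⊗-distribʳ = Consequences.comm∧distrˡ⇒distrʳ G.setoid G.∙-cong ⊗-comm ⊗-distribˡ

  scale-⊗ : ∀ u (p q : Poly (suc n)) → scale u p ⊗ q ≋ scale u (p ⊗ q)
  scale-⊗ u []       q = G.refl
  scale-⊗ u (a ∷ as) q = begin
    scale (u ⊗ a) q ⊕ shift (scale u as ⊗ q)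
      ≈⟨ G.∙-cong (G.sym (scale-assoc u a q)) (shift-cong (scale-⊗ u as q)) ⟩
    scale u (scale a q) ⊕ shift (scale u (as ⊗ q))   ≈⟨ ⊕-congˡ (scale u (scale a q)) (scale-shift u (as ⊗ q)) ⟨
    scale u (scale a q) ⊕ scale u (shift (as ⊗ q))   ≈⟨ scale-distribˡ u (scale a q) (shift (as ⊗ q)) ⟨
    scale u (scale a q ⊕ shift (as ⊗ q))             ∎

  shift-⊗ : ∀ (p q : Poly (suc n)) → shift p ⊗ q ≋ shift (p ⊗ q)
  shift-⊗ p q = G.trans (⊕-congʳ (shift (p ⊗ q)) (scale-zeroˡ q)) (G.identityˡ _)

  ⊗-assoc : ∀ (p q r : Poly (suc n)) → (p ⊗ q) ⊗ r ≋ p ⊗ (q ⊗ r)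
  ⊗-assoc []       q r = G.refl
  ⊗-assoc (a ∷ as) q r = begin
    (scale a q ⊕ shift (as ⊗ q)) ⊗ r        ≈⟨ ⊗-distribʳ r (scale a q) (shift (as ⊗ q)) ⟩
    scale a q ⊗ r ⊕ shift (as ⊗ q) ⊗ r      ≈⟨ G.∙-cong (scale-⊗ a q r) (shift-⊗ (as ⊗ q) r) ⟩
    scale a (q ⊗ r) ⊕ shift ((as ⊗ q) ⊗ r)  ≈⟨ ⊕-congˡ (scale a (q ⊗ r)) (shift-cong (⊗-assoc as q r)) ⟩
    scale a (q ⊗ r) ⊕ shift (as ⊗ (q ⊗ r))  ∎

  ⊗-identityˡ : ∀ (p : Poly (suc n)) → oneP ⊗ p ≋ p
  ⊗-identityˡ p = G.trans (ι-⊗ oneP p) (scale-identityˡ p)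

  isCommutativeRing : IsCommutativeRing (_≋_ {suc n}) _⊕_ _⊗_ negP zeroP oneP
  isCommutativeRing = isCommutativeRingˡ ⊗-cong ⊗-assoc ⊗-comm ⊗-identityˡ ⊗-distribˡ

polyIsCommutativeRing : ∀ n → IsCommutativeRing (_≋_ {n}) _⊕_ _⊗_ negP zeroP oneP
polyIsCommutativeRing zero    = isCommutativeRing₀
polyIsCommutativeRing (suc n) = AdjoinVariable.isCommutativeRing (polyIsCommutativeRing n)

polyRing : ℕ → CommutativeRing 0ℓ 0ℓ
polyRing n = record { isCommutativeRing = polyIsCommutativeRing n }

-- Finite sums and products

module RangeSums {c ℓ} (R : CommutativeRing c ℓ) where
  open CommutativeRing R
  open import Algebra.Properties.Ring ring using (-0#≈0#; -‿+-comm)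
  open import Algebra.Properties.CommutativeSemigroup +-commutativeSemigroup
    using () renaming (interchange to +-interchange)

  ∑< : ℕ → (ℕ → Carrier) → Carrier
  ∑< N f = foldr _+_ 0# (applyUpTo f N)

  ∏< : ℕ → (ℕ → Carrier) → Carrier
  ∏< N f = foldr _*_ 1# (applyUpTo f N)

  ∑<-upTo : ∀ N (f : ℕ → Carrier) → foldr _+_ 0# (map f (upTo N)) ≡ ∑< N f
  ∑<-upTo N f = cong (foldr _+_ 0#) (map-applyUpTo id f N)

  ∏<-upTo : ∀ N (f : ℕ → Carrier) → foldr _*_ 1# (map f (upTo N)) ≡ ∏< N f
  ∏<-upTo N f = cong (foldr _*_ 1#) (map-applyUpTo id f N)

  ∑<-cong : ∀ N {f g} → (∀ k → k < N → f k ≈ g k) → ∑< N f ≈ ∑< N g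
  ∑<-cong zero    f≈g = refl
  ∑<-cong (suc N) f≈g = +-cong (f≈g 0 (s≤s z≤n)) (∑<-cong N λ k k<N → f≈g (suc k) (s≤s k<N))

  ∑<-zero : ∀ N {f} → (∀ k → k < N → f k ≈ 0#) → ∑< N f ≈ 0#
  ∑<-zero N f≈0 = trans (∑<-cong N f≈0) (∑<-zero′ N)
    where
    ∑<-zero′ : ∀ N → ∑< N (λ _ → 0#) ≈ 0#
    ∑<-zero′ zero    = refl
    ∑<-zero′ (suc N) = trans (+-identityˡ _) (∑<-zero′ N)

  ∑<-single : ∀ N i {f} → i < N → (∀ k → k ≢ i → f k ≈ 0#) → ∑< N f ≈ f i
  ∑<-single (suc N) zero    _ f≈0 = trans (+-congˡ (∑<-zero N λ k _ → f≈0 (suc k) λ ())) (+-identityʳ _)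
  ∑<-single (suc N) (suc i) (s≤s i<N) f≈0 =
    trans (+-congʳ (f≈0 0 λ ())) (trans (+-identityˡ _)
      (∑<-single N i i<N λ k k≢i → f≈0 (suc k) (k≢i ∘ ℕ.suc-injective)))

  ∑<-+ : ∀ N f g → ∑< N (λ k → f k + g k) ≈ ∑< N f + ∑< N g
  ∑<-+ zero    f g = sym (+-identityˡ 0#)
  ∑<-+ (suc N) f g = trans (+-congˡ (∑<-+ N (f ∘ suc) (g ∘ suc)))
    (+-interchange (f 0) (g 0) (∑< N (f ∘ suc)) (∑< N (g ∘ suc)))

  ∑<-*ʳ : ∀ N f c → ∑< N f * c ≈ ∑< N (λ k → f k * c)
  ∑<-*ʳ zero    f c = zeroˡ c
  ∑<-*ʳ (suc N) f c = trans (distribʳ c (f 0) _) (+-congˡ (∑<-*ʳ N (f ∘ suc) c))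

  ∑<-suc : ∀ N f → ∑< (suc N) f ≈ ∑< N f + f N
  ∑<-suc zero    f = +-comm (f 0) 0#
  ∑<-suc (suc N) f = trans (+-congˡ (∑<-suc N (f ∘ suc))) (sym (+-assoc (f 0) _ _))

  ∑<-split : ∀ a b f → ∑< (a ℕ.+ b) f ≈ ∑< a f + ∑< b (λ d → f (a ℕ.+ d))
  ∑<-split zero    b f = sym (+-identityˡ _)
  ∑<-split (suc a) b f = trans (+-congˡ (∑<-split a b (f ∘ suc))) (sym (+-assoc (f 0) _ _))

  ∑<-neg : ∀ N f → ∑< N (λ k → - f k) ≈ - ∑< N f
  ∑<-neg zero    f = sym -0#≈0#
  ∑<-neg (suc N) f = trans (+-congˡ (∑<-neg N (f ∘ suc))) (-‿+-comm (f 0) _)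

  ∏<-suc : ∀ N f → ∏< (suc N) f ≈ ∏< N f * f N
  ∏<-suc zero    f = *-comm (f 0) 1#
  ∏<-suc (suc N) f = trans (*-congˡ (∏<-suc N (f ∘ suc))) (sym (*-assoc (f 0) _ _))

-- ℕ's _+_ enters the scope only here, after RangeSums, which uses the ring's _+_.
open import Data.Nat using (_+_)

-- Equivariant cohomology of ℙⁿ

module Cohomology (n : ℕ) where
  -- B = H_T^*(pt) = ℤ[β₁, …, βₙ] and H = B[ζ], of which H_T^*(ℙⁿ) is the quotient by σ_{n+1}
  module B = CommutativeRing (polyRing n)
  module H = CommutativeRing (polyRing (suc n))
  module ∑B = RangeSums (polyRing n)
  module ∑H = RangeSums (polyRing (suc n))
  open AdjoinVariable (polyIsCommutativeRing n) public using (scale; shift; shift-[]; ι-⊗; coeff₀-scale; coeff₀-ι-⊗)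

  ι-cong : ∀ {a b : Poly n} → a ≋ b → ι a ≋ ι b
  ι-cong a≋b = ∷-cong a≋b H.refl

  ι-⊗ι : ∀ (a b : Poly n) → ι (a ⊗ b) ≋ ι a ⊗ ι b
  ι-⊗ι a b = H.sym (ι-⊗ a (ι b))

  ι-⊗-zeroˡ : ∀ {a : Poly n} p → a ≋ zeroP → ι a ⊗ p ≋ zeroP
  ι-⊗-zeroˡ p a≋0 = H.trans (H.*-congʳ {p} (H.trans (ι-cong a≋0) shift-[])) (H.zeroˡ p)

  expansion : (ℕ → Poly n) → Poly (suc n)
  expansion c = ∑H.∑< (suc n) (λ k → ι (c k) ⊗ σ n k)

  expand≡expansion : ∀ c → expand n c ≡ expansion c
  expand≡expansion c = ∑H.∑<-upTo (suc n) (λ k → ι (c k) ⊗ σ n k)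

  -- β_m + ⋯ + β_k, that is t_m − t_{k+1}
  βRange : ℕ → ℕ → Poly n
  βRange m k = ∑B.∑< (suc k ∸ m) (λ d → βP (m + d))

  βRange-empty : ∀ {j k} → k ≤ j → βRange (suc j) k ≋ zeroP
  βRange-empty {j} k≤j = B.reflexive (cong (λ N → ∑B.∑< N λ d → βP (suc j + d)) (ℕ.m≤n⇒m∸n≡0 k≤j))

  tP-split : ∀ m k → m ≤ suc k → k ≤ n → tP n m ≋ tP n (suc k) ⊕ βRange m k
  tP-split m k m≤1+k k≤n = begin
    tP n m                                                   ≡⟨ ∑B.∑<-upTo (suc n ∸ m) β[m+_] ⟩
    ∑B.∑< (suc n ∸ m) β[m+_]                                 ≡⟨ cong (λ N → ∑B.∑< N β[m+_]) length-split ⟩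
    ∑B.∑< ((suc k ∸ m) + (n ∸ k)) β[m+_]                     ≈⟨ ∑B.∑<-split (suc k ∸ m) (n ∸ k) β[m+_] ⟩
    βRange m k ⊕ ∑B.∑< (n ∸ k) (λ d → βP (m + (suc k ∸ m + d)))
      ≈⟨ B.+-congˡ (∑B.∑<-cong (n ∸ k) λ d _ → B.reflexive (cong βP (index-shift d))) ⟩
    βRange m k ⊕ ∑B.∑< (n ∸ k) (λ d → βP (suc k + d))
      ≡⟨ cong (βRange m k ⊕_) (∑B.∑<-upTo (n ∸ k) _) ⟨
    βRange m k ⊕ tP n (suc k)                                ≈⟨ B.+-comm _ _ ⟩
    tP n (suc k) ⊕ βRange m k                                ∎
    where
    open ≈-Reasoning B.setoid
    β[m+_] : ℕ → Poly n
    β[m+ d ] = βP (m + d)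
    length-split : suc n ∸ m ≡ (suc k ∸ m) + (n ∸ k)
    length-split = ≡.trans (cong (_∸ m) (≡.sym (ℕ.m+[n∸m]≡n (s≤s k≤n)))) (ℕ.+-∸-comm (n ∸ k) m≤1+k)
    index-shift : ∀ d → m + (suc k ∸ m + d) ≡ suc k + d
    index-shift d = ≡.trans (≡.sym (ℕ.+-assoc m (suc k ∸ m) d)) (cong (_+ d) (ℕ.m+[n∸m]≡n m≤1+k))

  ζ+t-split : ∀ m k → m ≤ suc k → k ≤ n → ζ+t n m ≋ ζ+t n (suc k) ⊕ ι (βRange m k)
  ζ+t-split m k m≤1+k k≤n = ∷-cong (tP-split m k m≤1+k k≤n) H.refl

  σ-suc : ∀ k → σ n (suc k) ≋ σ n k ⊗ ζ+t n (suc k)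
  σ-suc k = begin
    σ n (suc k)                             ≡⟨ ∑H.∏<-upTo (suc k) ζ+t[1+_] ⟩
    ∑H.∏< (suc k) ζ+t[1+_]                  ≈⟨ ∑H.∏<-suc k ζ+t[1+_] ⟩
    ∑H.∏< k ζ+t[1+_] ⊗ ζ+t n (suc k)        ≡⟨ cong (_⊗ ζ+t n (suc k)) (∑H.∏<-upTo k ζ+t[1+_]) ⟨
    σ n k ⊗ ζ+t n (suc k)                   ∎
    where
    open ≈-Reasoning H.setoid
    ζ+t[1+_] : ℕ → Poly (suc n)
    ζ+t[1+ d ] = ζ+t n (suc d)

  σ-⊗-ζ+t : ∀ {j k} → j ≤ k → k ≤ n →
            σ n k ⊗ ζ+t n (suc j) ≋ σ n (suc k) ⊕ ι (βRange (suc j) k) ⊗ σ n k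
  σ-⊗-ζ+t {j} {k} j≤k k≤n = begin
    σ n k ⊗ ζ+t n (suc j)                             ≈⟨ H.*-congˡ {σ n k} (ζ+t-split (suc j) k (s≤s j≤k) k≤n) ⟩
    σ n k ⊗ (ζ+t n (suc k) ⊕ ι L)                     ≈⟨ H.distribˡ (σ n k) (ζ+t n (suc k)) (ι L) ⟩
    σ n k ⊗ ζ+t n (suc k) ⊕ σ n k ⊗ ι L               ≈⟨ H.+-cong (H.sym (σ-suc k)) (H.*-comm (σ n k) (ι L)) ⟩
    σ n (suc k) ⊕ ι L ⊗ σ n k                         ∎
    where
    open ≈-Reasoning H.setoid
    L = βRange (suc j) k

-- Structure constants

-- C j k is C^k_{i,j}.
module StructureConstants (n i : ℕ) where
  open Cohomology n
  private
    module +-CS = CommSemigroupProperties H.+-commutativeSemigroup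
    module *-CS = CommSemigroupProperties H.*-commutativeSemigroup

  mutual
    C : ℕ → ℕ → Poly n
    C zero    k = if does (k ≟ i) then oneP else zeroP
    C (suc j) k = C↓ j k ⊕ βRange (suc j) k ⊗ C j k

    C↓ : ℕ → ℕ → Poly n
    C↓ j zero    = zeroP
    C↓ j (suc k) = C j k

  remainder : ℕ → Poly (suc n)
  remainder zero    = zeroP
  remainder (suc j) = remainder j ⊗ ζ+t n (suc j) ⊕ ι (C j n)

  C₀-diagonal : C 0 i ≡ oneP
  C₀-diagonal = cong (if_then oneP else zeroP) (dec-true (i ≟ i) ≡.refl)

  C₀-off-diagonal : ∀ {k} → k ≢ i → C 0 k ≡ zeroP
  C₀-off-diagonal {k} k≢i = cong (if_then oneP else zeroP) (dec-false (k ≟ i) k≢i)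

  C-vanishes : ∀ j k → k < j → C j k ≋ zeroP
  C-vanishes (suc j) k (s≤s k≤j) = B.trans
    (B.+-cong (C↓-vanishes k k≤j) (B.trans (B.*-congʳ {C j k} (βRange-empty k≤j)) (B.zeroˡ _)))
    (B.+-identityˡ zeroP)
    where
    C↓-vanishes : ∀ k → k ≤ j → C↓ j k ≋ zeroP
    C↓-vanishes zero    _   = B.refl
    C↓-vanishes (suc k) k<j = C-vanishes j k k<j

  expansion-C₀ : i ≤ n → expansion (C 0) ≋ σ n i
  expansion-C₀ i≤n = H.trans
    (∑H.∑<-single (suc n) i (s≤s i≤n) λ k k≢i →
      ι-⊗-zeroˡ (σ n k) (B.reflexive (C₀-off-diagonal k≢i)))
    (H.trans (H.*-congʳ {σ n i} (H.reflexive (cong ι C₀-diagonal))) (H.*-identityˡ (σ n i)))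

  expansion-term-⊗-ζ+t : ∀ j k → k ≤ n →
    (ι (C j k) ⊗ σ n k) ⊗ ζ+t n (suc j) ≋ ι (C j k) ⊗ σ n (suc k) ⊕ ι (βRange (suc j) k ⊗ C j k) ⊗ σ n k
  expansion-term-⊗-ζ+t j k k≤n with j ℕ.≤? k
  ... | yes j≤k = begin
    (ι c ⊗ σ n k) ⊗ ζ+t n (suc j)                ≈⟨ H.*-assoc (ι c) (σ n k) (ζ+t n (suc j)) ⟩
    ι c ⊗ (σ n k ⊗ ζ+t n (suc j))                ≈⟨ H.*-congˡ {ι c} (σ-⊗-ζ+t j≤k k≤n) ⟩
    ι c ⊗ (σ n (suc k) ⊕ ι L ⊗ σ n k)            ≈⟨ H.distribˡ (ι c) (σ n (suc k)) (ι L ⊗ σ n k) ⟩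
    ι c ⊗ σ n (suc k) ⊕ ι c ⊗ (ι L ⊗ σ n k)
      ≈⟨ H.+-congˡ {ι c ⊗ σ n (suc k)} (H.sym (H.*-assoc (ι c) (ι L) (σ n k))) ⟩
    ι c ⊗ σ n (suc k) ⊕ (ι c ⊗ ι L) ⊗ σ n k
      ≈⟨ H.+-congˡ {ι c ⊗ σ n (suc k)} (H.*-congʳ {σ n k} (H.trans (H.*-comm (ι c) (ι L)) (H.sym (ι-⊗ι L c)))) ⟩
    ι c ⊗ σ n (suc k) ⊕ ι (L ⊗ c) ⊗ σ n k        ∎
    where
    open ≈-Reasoning H.setoid
    c = C j k
    L = βRange (suc j) k
  ... | no j≰k = H.trans (H.trans (H.*-congʳ {ζ+t n (suc j)} (ι-⊗-zeroˡ (σ n k) C≋0)) (H.zeroˡ (ζ+t n (suc j))))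
    (H.sym (H.trans (H.+-cong (ι-⊗-zeroˡ (σ n (suc k)) C≋0)
                              (ι-⊗-zeroˡ (σ n k) (B.trans (B.*-congˡ {βRange (suc j) k} C≋0) (B.zeroʳ _))))
                    (H.+-identityˡ zeroP)))
    where
    C≋0 = C-vanishes j k (ℕ.≰⇒> j≰k)

  expansion-⊗-ζ+t : ∀ j → expansion (C j) ⊗ ζ+t n (suc j) ≋ expansion (C (suc j)) ⊕ ι (C j n) ⊗ σ n (suc n)
  expansion-⊗-ζ+t j = begin
    expansion (C j) ⊗ Z                              ≈⟨ ∑H.∑<-*ʳ (suc n) (λ k → ι (C j k) ⊗ σ n k) Z ⟩
    ∑H.∑< (suc n) (λ k → (ι (C j k) ⊗ σ n k) ⊗ Z)
      ≈⟨ ∑H.∑<-cong (suc n) (λ k k<1+n → expansion-term-⊗-ζ+t j k (ℕ.≤-pred k<1+n)) ⟩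
    ∑H.∑< (suc n) (λ k → F (suc k) ⊕ G k)            ≈⟨ ∑H.∑<-+ (suc n) (F ∘ suc) G ⟩
    ∑H.∑< (suc n) (F ∘ suc) ⊕ ∑G                     ≈⟨ H.+-congʳ {∑G} ∑F∘suc ⟩
    (∑F ⊕ F (suc n)) ⊕ ∑G                            ≈⟨ +-CS.xy∙z≈xz∙y ∑F (F (suc n)) ∑G ⟩
    (∑F ⊕ ∑G) ⊕ F (suc n)                            ≈⟨ H.+-congʳ {F (suc n)} expansion-C-suc ⟨
    expansion (C (suc j)) ⊕ ι (C j n) ⊗ σ n (suc n)  ∎
    where
    open ≈-Reasoning H.setoid
    Z = ζ+t n (suc j)
    F G : ℕ → Poly (suc n)
    F k = ι (C↓ j k) ⊗ σ n k
    G k = ι (βRange (suc j) k ⊗ C j k) ⊗ σ n k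
    ∑F = ∑H.∑< (suc n) F
    ∑G = ∑H.∑< (suc n) G
    ∑F∘suc : ∑H.∑< (suc n) (F ∘ suc) ≋ ∑F ⊕ F (suc n)
    ∑F∘suc = H.trans (H.sym (H.trans (H.+-congʳ {∑H.∑< (suc n) (F ∘ suc)} (ι-⊗-zeroˡ (σ n 0) B.refl))
                                     (H.+-identityˡ _)))
                     (∑H.∑<-suc (suc n) F)
    expansion-C-suc : expansion (C (suc j)) ≋ ∑F ⊕ ∑G
    expansion-C-suc = H.trans
      (∑H.∑<-cong (suc n) λ k _ → H.distribʳ (σ n k) (ι (C↓ j k)) (ι (βRange (suc j) k ⊗ C j k)))
      (∑H.∑<-+ (suc n) F G)

  σσ-expansion : i ≤ n → ∀ j → σ n i ⊗ σ n j ≋ expansion (C j) ⊕ remainder j ⊗ σ n (suc n)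
  σσ-expansion i≤n zero = H.trans (H.*-identityʳ (σ n i))
    (H.trans (H.sym (expansion-C₀ i≤n)) (H.sym (H.+-identityʳ (expansion (C 0)))))
  σσ-expansion i≤n (suc j) = begin
    σ n i ⊗ σ n (suc j)                                ≈⟨ H.*-congˡ {σ n i} (σ-suc j) ⟩
    σ n i ⊗ (σ n j ⊗ Z)                                ≈⟨ H.*-assoc (σ n i) (σ n j) Z ⟨
    (σ n i ⊗ σ n j) ⊗ Z                                ≈⟨ H.*-congʳ {Z} (σσ-expansion i≤n j) ⟩
    (expansion (C j) ⊕ remainder j ⊗ S) ⊗ Z            ≈⟨ H.distribʳ Z (expansion (C j)) (remainder j ⊗ S) ⟩
    expansion (C j) ⊗ Z ⊕ (remainder j ⊗ S) ⊗ Z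
      ≈⟨ H.+-cong (expansion-⊗-ζ+t j) (*-CS.xy∙z≈xz∙y (remainder j) S Z) ⟩
    (expansion (C (suc j)) ⊕ ι (C j n) ⊗ S) ⊕ (remainder j ⊗ Z) ⊗ S
      ≈⟨ +-CS.xy∙z≈x∙zy (expansion (C (suc j))) (ι (C j n) ⊗ S) ((remainder j ⊗ Z) ⊗ S) ⟩
    expansion (C (suc j)) ⊕ ((remainder j ⊗ Z) ⊗ S ⊕ ι (C j n) ⊗ S)
      ≈⟨ H.+-congˡ {expansion (C (suc j))} (H.distribʳ S (remainder j ⊗ Z) (ι (C j n))) ⟨
    expansion (C (suc j)) ⊕ remainder (suc j) ⊗ S      ∎
    where
    open ≈-Reasoning H.setoid
    Z = ζ+t n (suc j)
    S = σ n (suc n)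

module Uniqueness (n : ℕ) where
  open Cohomology n
  open AdjoinVariable (polyIsCommutativeRing n) using (shift-cong; ⊗-congˡ)
  private
    module BP = Algebra.Properties.Ring B.ring
    module HP = Algebra.Properties.Ring H.ring
  open import Algebra.Properties.CommutativeSemigroup H.+-commutativeSemigroup
    using () renaming (interchange to +-interchange)

  DegreeBelow : ℕ → Poly (suc n) → Set
  DegreeBelow N p = ∀ a → N ≤ a → coeff₀ p a ≋ zeroP

  Monic : ℕ → Poly (suc n) → Set
  Monic N p = coeff₀ p N ≋ oneP × DegreeBelow (suc N) p

  coeff₀-∑< : ∀ N (f : ℕ → Poly (suc n)) a → coeff₀ (∑H.∑< N f) a ≋ ∑B.∑< N (λ k → coeff₀ (f k) a)
  coeff₀-∑< zero    f a = B.refl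
  coeff₀-∑< (suc N) f a =
    B.trans (coeff₀-⊕ (f 0) _ a) (B.+-congˡ {coeff₀ (f 0) a} (coeff₀-∑< N (f ∘ suc) a))

  coeff₀-σ-suc : ∀ k a →
    coeff₀ (σ n (suc k)) (suc a) ≋ tP n (suc k) ⊗ coeff₀ (σ n k) (suc a) ⊕ coeff₀ (σ n k) a
  coeff₀-σ-suc k a = begin
    coeff₀ (σ n (suc k)) (suc a)
      ≈⟨ coeff₀-cong (H.trans (σ-suc k) (H.*-comm (σ n k) _)) (suc a) ⟩
    coeff₀ (scale t (σ n k) ⊕ shift (oneP ⊗ σ n k)) (suc a) ≈⟨ coeff₀-⊕ (scale t (σ n k)) _ (suc a) ⟩
    coeff₀ (scale t (σ n k)) (suc a) ⊕ coeff₀ (oneP ⊗ σ n k) a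
      ≈⟨ B.+-cong (coeff₀-scale t (σ n k) (suc a)) (coeff₀-cong (H.*-identityˡ (σ n k)) a) ⟩
    t ⊗ coeff₀ (σ n k) (suc a) ⊕ coeff₀ (σ n k) a         ∎
    where
    open ≈-Reasoning B.setoid
    t = tP n (suc k)

  σ-monic : ∀ k → Monic k (σ n k)
  σ-monic zero    = B.refl , λ { (suc a) _ → B.refl }
  σ-monic (suc k) = top , above
    where
    σ-below : ∀ {a} b → coeff₀ (σ n k) (suc a) ≋ zeroP → coeff₀ (σ n k) a ≋ b →
              coeff₀ (σ n (suc k)) (suc a) ≋ b
    σ-below b h₁ h₂ = B.trans (coeff₀-σ-suc k _)
      (B.trans (B.+-cong (B.trans (B.*-congˡ {tP n (suc k)} h₁) (B.zeroʳ _)) h₂) (B.+-identityˡ b))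
    top = σ-below oneP (proj₂ (σ-monic k) (suc k) ℕ.≤-refl) (proj₁ (σ-monic k))
    above : DegreeBelow (suc (suc k)) (σ n (suc k))
    above (suc a) (s≤s k<a) =
      σ-below zeroP (proj₂ (σ-monic k) (suc a) (ℕ.m≤n⇒m≤1+n k<a)) (proj₂ (σ-monic k) a k<a)

  expansion-degree : ∀ N (u : ℕ → Poly n) → DegreeBelow N (∑H.∑< N (λ k → ι (u k) ⊗ σ n k))
  expansion-degree N u a N≤a = B.trans (coeff₀-∑< N _ a) (∑B.∑<-zero N λ k k<N →
    B.trans (coeff₀-ι-⊗ (u k) (σ n k) a)
      (B.trans (B.*-congˡ {u k} (proj₂ (σ-monic k) a (ℕ.<-≤-trans k<N N≤a))) (B.zeroʳ (u k))))

  multiple-of-monic : ∀ N {M : Poly (suc n)} r → Monic N M → DegreeBelow N (r ⊗ M) → r ≋ zeroP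
  multiple-of-monic N             []       _               _   = H.refl
  multiple-of-monic N {M} (u ∷ us) (M-top , M-deg) rM-deg =
    H.trans (∷-cong u≋0 us≋0) shift-[]
    where
    coeff₀-rM : ∀ a → coeff₀ ((u ∷ us) ⊗ M) a ≋ u ⊗ coeff₀ M a ⊕ coeff₀ (shift (us ⊗ M)) a
    coeff₀-rM a = B.trans (coeff₀-⊕ (scale u M) _ a) (B.+-congʳ {coeff₀ (shift (us ⊗ M)) a} (coeff₀-scale u M a))
    us≋0 : us ≋ zeroP
    us≋0 = multiple-of-monic N us (M-top , M-deg) λ a N≤a →
      B.trans (B.sym (B.trans (B.+-congʳ {coeff₀ (us ⊗ M) a}
                                 (B.trans (B.*-congˡ {u} (M-deg (suc a) (s≤s N≤a))) (B.zeroʳ u)))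
                              (B.+-identityˡ _)))
              (B.trans (B.sym (coeff₀-rM (suc a))) (rM-deg (suc a) (ℕ.m≤n⇒m≤1+n N≤a)))
    u≋0 : u ≋ zeroP
    u≋0 = begin
      u                                                 ≈⟨ B.*-identityʳ u ⟨
      u ⊗ oneP                                          ≈⟨ B.*-congˡ {u} M-top ⟨
      u ⊗ coeff₀ M N                                    ≈⟨ B.+-identityʳ _ ⟨
      u ⊗ coeff₀ M N ⊕ zeroP
        ≈⟨ B.+-congˡ {u ⊗ coeff₀ M N} (coeff₀-cong (H.trans (shift-cong (⊗-congˡ M us≋0)) shift-[]) N) ⟨
      u ⊗ coeff₀ M N ⊕ coeff₀ (shift (us ⊗ M)) N        ≈⟨ coeff₀-rM N ⟨
      coeff₀ ((u ∷ us) ⊗ M) N                           ≈⟨ rM-deg N ℕ.≤-refl ⟩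
      zeroP                                             ∎
      where open ≈-Reasoning B.setoid

  expansion-injective : ∀ N (u : ℕ → Poly n) → ∑H.∑< N (λ k → ι (u k) ⊗ σ n k) ≋ zeroP →
                        ∀ k → k < N → u k ≋ zeroP
  expansion-injective (suc N) u ∑≋0 k k<1+N = split (ℕ.m≤n⇒m<n∨m≡n (ℕ.≤-pred k<1+N))
    where
    f : ℕ → Poly (suc n)
    f k = ι (u k) ⊗ σ n k
    ∑≋f[N]≋0 : ∑H.∑< N f ⊕ f N ≋ zeroP
    ∑≋f[N]≋0 = H.trans (H.sym (∑H.∑<-suc N f)) ∑≋0
    u[N]≋0 : u N ≋ zeroP
    u[N]≋0 = begin
      u N                                          ≈⟨ B.*-identityʳ (u N) ⟨
      u N ⊗ oneP                                   ≈⟨ B.*-congˡ {u N} (proj₁ (σ-monic N)) ⟨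
      u N ⊗ coeff₀ (σ n N) N                       ≈⟨ coeff₀-ι-⊗ (u N) (σ n N) N ⟨
      coeff₀ (f N) N                               ≈⟨ B.+-identityˡ _ ⟨
      zeroP ⊕ coeff₀ (f N) N
        ≈⟨ B.+-congʳ {coeff₀ (f N) N} (expansion-degree N u N ℕ.≤-refl) ⟨
      coeff₀ (∑H.∑< N f) N ⊕ coeff₀ (f N) N        ≈⟨ coeff₀-⊕ (∑H.∑< N f) (f N) N ⟨
      coeff₀ (∑H.∑< N f ⊕ f N) N                   ≈⟨ coeff₀-cong ∑≋f[N]≋0 N ⟩
      zeroP                                        ∎
      where open ≈-Reasoning B.setoid
    split : k < N ⊎ k ≡ N → u k ≋ zeroP
    split (inj₁ k<N) = expansion-injective N u
      (H.trans (H.sym (H.+-identityʳ _))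
               (H.trans (H.+-congˡ {∑H.∑< N f} (H.sym (ι-⊗-zeroˡ (σ n N) u[N]≋0))) ∑≋f[N]≋0))
      k k<N
    split (inj₂ ≡.refl) = u[N]≋0

  private
    x+y≈z+w⇒x-z≈w-y : ∀ a b c d → a ⊕ b ≋ c ⊕ d → a ⊕ negP c ≋ d ⊕ negP b
    x+y≈z+w⇒x-z≈w-y a b c d h = begin
      a ⊕ negP c                                  ≈⟨ H.+-identityʳ _ ⟨
      (a ⊕ negP c) ⊕ zeroP                        ≈⟨ H.+-congˡ {a ⊕ negP c} (H.-‿inverseʳ b) ⟨
      (a ⊕ negP c) ⊕ (b ⊕ negP b)                 ≈⟨ +-interchange a (negP c) b (negP b) ⟩
      (a ⊕ b) ⊕ (negP c ⊕ negP b)                 ≈⟨ H.+-congʳ {negP c ⊕ negP b} h ⟩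
      (c ⊕ d) ⊕ (negP c ⊕ negP b)                 ≈⟨ +-interchange c d (negP c) (negP b) ⟩
      (c ⊕ negP c) ⊕ (d ⊕ negP b)                 ≈⟨ H.+-congʳ {d ⊕ negP b} (H.-‿inverseʳ c) ⟩
      zeroP ⊕ (d ⊕ negP b)                        ≈⟨ H.+-identityˡ _ ⟩
      d ⊕ negP b                                  ∎
      where open ≈-Reasoning H.setoid

  expansion-unique : ∀ (c c' : ℕ → Poly n) q q' →
                     expansion c ⊕ q ⊗ σ n (suc n) ≋ expansion c' ⊕ q' ⊗ σ n (suc n) →
                     ∀ k → k ≤ n → c k ≋ c' k
  expansion-unique c c' q q' h k k≤n =
    BP.x∙y⁻¹≈ε⇒x≈y (c k) (c' k) (expansion-injective (suc n) u expansion-u≋0 k (s≤s k≤n))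
    where
    S = σ n (suc n)
    u : ℕ → Poly n
    u k = c k ⊕ negP (c' k)
    r : Poly (suc n)
    r = q' ⊕ negP q
    expansion-u≋rS : expansion u ≋ r ⊗ S
    expansion-u≋rS = begin
      expansion u
        ≈⟨ ∑H.∑<-cong (suc n) (λ k _ → H.trans (H.distribʳ (σ n k) (ι (c k)) (negP (ι (c' k))))
                                     (H.+-congˡ {ι (c k) ⊗ σ n k} (H.sym (HP.-‿distribˡ-* (ι (c' k)) (σ n k))))) ⟩
      ∑H.∑< (suc n) (λ k → ι (c k) ⊗ σ n k ⊕ negP (ι (c' k) ⊗ σ n k))
        ≈⟨ ∑H.∑<-+ (suc n) (λ k → ι (c k) ⊗ σ n k) (λ k → negP (ι (c' k) ⊗ σ n k)) ⟩
      expansion c ⊕ ∑H.∑< (suc n) (λ k → negP (ι (c' k) ⊗ σ n k))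
        ≈⟨ H.+-congˡ {expansion c} (∑H.∑<-neg (suc n) (λ k → ι (c' k) ⊗ σ n k)) ⟩
      expansion c ⊕ negP (expansion c')
        ≈⟨ x+y≈z+w⇒x-z≈w-y (expansion c) (q ⊗ S) (expansion c') (q' ⊗ S) h ⟩
      q' ⊗ S ⊕ negP (q ⊗ S)                            ≈⟨ H.+-congˡ {q' ⊗ S} (HP.-‿distribˡ-* q S) ⟩
      q' ⊗ S ⊕ negP q ⊗ S                              ≈⟨ H.distribʳ S q' (negP q) ⟨
      r ⊗ S                                            ∎
      where open ≈-Reasoning H.setoid
    r≋0 : r ≋ zeroP
    r≋0 = multiple-of-monic (suc n) r (σ-monic (suc n)) λ a n<a →
      B.trans (coeff₀-cong (H.sym expansion-u≋rS) a) (expansion-degree (suc n) u a n<a)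
    expansion-u≋0 : expansion u ≋ zeroP
    expansion-u≋0 = H.trans expansion-u≋rS (H.trans (H.*-congʳ {S} r≋0) (H.zeroˡ S))

-- Supports

NonNegative : ∀ {n} → Poly n → Set
NonNegative p = ∀ e → 0ℤ ℤ.≤ coeff p e

module _ {n : ℕ} where

  Supp-≋ : ∀ {p q : Poly n} → p ≋ q → ∀ x → Supp p x ⇔ Supp q x
  Supp-≋ (mk≋ p≈q) x = mk⇔ (λ p[x]≢0 → p[x]≢0 ∘ ≡.trans (p≈q x))
                           (λ q[x]≢0 → q[x]≢0 ∘ ≡.trans (≡.sym (p≈q x)))

  NonNegative-≋ : ∀ {p q : Poly n} → p ≋ q → NonNegative p → NonNegative q
  NonNegative-≋ (mk≋ p≈q) p≥0 e = ≡.subst (0ℤ ℤ.≤_) (p≈q e) (p≥0 e)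

  NonNegative-zeroP : NonNegative (zeroP {n})
  NonNegative-zeroP e = ≡.subst (0ℤ ℤ.≤_) (≡.sym (coeff-zeroP e)) (ℤ.+≤+ z≤n)

  ¬Supp-zeroP : ∀ x → ¬ Supp (zeroP {n}) x
  ¬Supp-zeroP x zeroP[x]≢0 = zeroP[x]≢0 (coeff-zeroP x)

private
  ≢0-⊕ : ∀ {a b} → 0ℤ ℤ.≤ a → 0ℤ ℤ.≤ b → (a ℤ.+ b ≢ 0ℤ) ⇔ (a ≢ 0ℤ ⊎ b ≢ 0ℤ)
  ≢0-⊕ {ℤ.+ zero}  {ℤ.+ _} _ _ = mk⇔ inj₂ [ (λ 0≢0 → ⊥-elim (0≢0 ≡.refl)) , (λ b≢0 → b≢0) ]
  ≢0-⊕ {ℤ.+ suc _} {ℤ.+ _} _ _ = mk⇔ (λ _ → inj₁ λ ()) (λ _ ())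

module _ {n : ℕ} where
  open RangeSums (polyRing n)
  open ≈-Reasoning (⇔.⇔-setoid 0ℓ)

  NonNegative-⊕ : ∀ {p q : Poly n} → NonNegative p → NonNegative q → NonNegative (p ⊕ q)
  NonNegative-⊕ {p} {q} p≥0 q≥0 e =
    ≡.subst (0ℤ ℤ.≤_) (≡.sym (coeff-⊕ p q e)) (ℤ.+-mono-≤ (p≥0 e) (q≥0 e))

  Supp-⊕ : ∀ {p q : Poly n} → NonNegative p → NonNegative q →
           ∀ x → Supp (p ⊕ q) x ⇔ (Supp p x ⊎ Supp q x)
  Supp-⊕ {p} {q} p≥0 q≥0 x = begin
    coeff (p ⊕ q) x ≢ 0ℤ                 ≡⟨ cong (_≢ 0ℤ) (coeff-⊕ p q x) ⟩
    coeff p x ℤ.+ coeff q x ≢ 0ℤ         ≈⟨ ≢0-⊕ (p≥0 x) (q≥0 x) ⟩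
    (Supp p x ⊎ Supp q x)                ∎

  NonNegative-∑< : ∀ N {f} → (∀ d → d < N → NonNegative (f d)) → NonNegative (∑< N f)
  NonNegative-∑< zero    f≥0 = NonNegative-zeroP
  NonNegative-∑< (suc N) f≥0 =
    NonNegative-⊕ (f≥0 0 (s≤s z≤n)) (NonNegative-∑< N λ d d<N → f≥0 (suc d) (s≤s d<N))

  Supp-∑< : ∀ N {f} → (∀ d → d < N → NonNegative (f d)) →
            ∀ x → Supp (∑< N f) x ⇔ ∃ λ d → d < N × Supp (f d) x
  Supp-∑< zero    f≥0 x = mk⇔ (⊥-elim ∘ ¬Supp-zeroP x) λ ()
  Supp-∑< (suc N) {f} f≥0 x = begin
    Supp (f 0 ⊕ ∑< N (f ∘ suc)) x
      ≈⟨ Supp-⊕ (f≥0 0 (s≤s z≤n)) (NonNegative-∑< N f∘suc≥0) x ⟩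
    (Supp (f 0) x ⊎ Supp (∑< N (f ∘ suc)) x)
      ≈⟨ ⇔.refl ⊎-⇔ Supp-∑< N f∘suc≥0 x ⟩
    (Supp (f 0) x ⊎ ∃ λ d → d < N × Supp (f (suc d)) x)
      ≈⟨ mk⇔ [ (λ s → 0 , s≤s z≤n , s) , (λ (d , d<N , s) → suc d , s≤s d<N , s) ]
             (λ { (zero , _ , s) → inj₁ s ; (suc d , s≤s d<N , s) → inj₂ (d , d<N , s) }) ⟩
    (∃ λ d → d < suc N × Supp (f d) x)   ∎
    where f∘suc≥0 = λ d d<N → f≥0 (suc d) (s≤s d<N)

coeff-cong : ∀ {n} (p : Poly n) {x y} → x ≗ y → coeff p x ≡ coeff p y
coeff-cong {zero}  p         x≗y = ≡.refl
coeff-cong {suc n} p {x} {y} x≗y = ≡.trans (cong (λ d → coeff (coeff₀ p d) (tail x)) (x≗y zero))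
                                           (coeff-cong (coeff₀ p (head y)) (x≗y ∘ suc))

NonNegative-oneP : ∀ {n} → NonNegative (oneP {n})
NonNegative-oneP {zero}  e = ℤ.+≤+ z≤n
NonNegative-oneP {suc n} e with head e
... | zero  = NonNegative-oneP (tail e)
... | suc _ = NonNegative-zeroP (tail e)

Supp-oneP : ∀ {n} x → Supp (oneP {n}) x ⇔ (∀ m → x m ≡ 0)
Supp-oneP {zero}  x = mk⇔ (λ _ ()) (λ _ ())
Supp-oneP {suc n} x with head x in x₀≡
... | zero  = mk⇔ (λ s → λ { zero → x₀≡ ; (suc m) → Equivalence.to (Supp-oneP (tail x)) s m })
                  (λ x≗0 → Equivalence.from (Supp-oneP (tail x)) (x≗0 ∘ suc))
... | suc _ = mk⇔ (⊥-elim ∘ ¬Supp-zeroP (tail x)) (λ x≗0 → case ≡.trans (≡.sym x₀≡) (x≗0 zero) of λ ())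

module _ {n : ℕ} where
  open AdjoinVariable (polyIsCommutativeRing n) using (shift; shift-⊗; shift-cong; coeff₀-ι-⊗)
  private module H = CommutativeRing (polyRing (suc n))

  varN₀-⊗ : ∀ (P : Poly (suc n)) → varN 0 ⊗ P ≋ shift P
  varN₀-⊗ P = H.trans (shift-⊗ oneP P) (shift-cong (H.*-identityˡ P))

  coeff-ι-⊗ : ∀ a (P : Poly (suc n)) e → coeff (ι a ⊗ P) e ≡ coeff (a ⊗ coeff₀ P (head e)) (tail e)
  coeff-ι-⊗ a P e = coeff-≡ (coeff₀-ι-⊗ a P (head e)) (tail e)

-- updateAt y v suc is the exponent y + e_v.
coeff-var-⊗-raised : ∀ {n} (v : Fin n) P y → coeff (varN (toℕFin v) ⊗ P) (updateAt y v suc) ≡ coeff P y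
coeff-var-⊗-raised {suc n} zero    P y = coeff-≡ (varN₀-⊗ P) (updateAt y zero suc)
coeff-var-⊗-raised {suc n} (suc v) P y = ≡.trans (coeff-ι-⊗ (varN (toℕFin v)) P (updateAt y (suc v) suc))
  (coeff-var-⊗-raised v (coeff₀ P (head y)) (tail y))

coeff-var-⊗-unraised : ∀ {n} (v : Fin n) P x → x v ≡ 0 → coeff (varN (toℕFin v) ⊗ P) x ≡ 0ℤ
coeff-var-⊗-unraised {suc n} zero    P x x₀≡0 = ≡.trans (coeff-≡ (varN₀-⊗ P) x)
  (≡.trans (cong (λ d → coeff (coeff₀ (zeroP ∷ P) d) (tail x)) x₀≡0) (coeff-zeroP (tail x)))
coeff-var-⊗-unraised {suc n} (suc v) P x xᵥ≡0 = ≡.trans (coeff-ι-⊗ (varN (toℕFin v)) P x)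
  (coeff-var-⊗-unraised v (coeff₀ P (head x)) (tail x) xᵥ≡0)

unraise : ∀ {n} (x : Fin n → ℕ) v → x v ≡ 0 ⊎ x ≗ updateAt (updateAt x v pred) v suc
unraise x v with x v in xᵥ≡
... | zero  = inj₁ ≡.refl
... | suc _ = inj₂ λ m → ≡.sym (≡.trans
  (updateAt-updateAt-local v x (≡.trans (cong (λ (m : ℕ) → suc (pred m)) xᵥ≡) (≡.sym xᵥ≡)) m) (updateAt-id v x m))

NonNegative-var-⊗ : ∀ {n} (v : Fin n) {P} → NonNegative P → NonNegative (varN (toℕFin v) ⊗ P)
NonNegative-var-⊗ v {P} P≥0 x with unraise x v
... | inj₁ xᵥ≡0 = ≡.subst (0ℤ ℤ.≤_) (≡.sym (coeff-var-⊗-unraised v P x xᵥ≡0)) (ℤ.+≤+ z≤n)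
... | inj₂ x≗y+eᵥ = ≡.subst (0ℤ ℤ.≤_)
  (≡.sym (≡.trans (coeff-cong _ x≗y+eᵥ) (coeff-var-⊗-raised v P _))) (P≥0 _)

Supp-var-⊗ : ∀ {n} (v : Fin n) P x →
             Supp (varN (toℕFin v) ⊗ P) x ⇔ ∃ λ y → Supp P y × x ≗ updateAt y v suc
Supp-var-⊗ v P x = mk⇔ to from
  where
  to : Supp (varN (toℕFin v) ⊗ P) x → ∃ λ y → Supp P y × x ≗ updateAt y v suc
  to s with unraise x v
  ... | inj₁ xᵥ≡0   = ⊥-elim (s (coeff-var-⊗-unraised v P x xᵥ≡0))
  ... | inj₂ x≗y+eᵥ = _ , (λ P[y]≡0 → s (≡.trans (coeff-cong _ x≗y+eᵥ)
                                                  (≡.trans (coeff-var-⊗-raised v P _) P[y]≡0))) , x≗y+eᵥ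
  from : (∃ λ y → Supp P y × x ≗ updateAt y v suc) → Supp (varN (toℕFin v) ⊗ P) x
  from (y , s , x≗y+eᵥ) vP[x]≡0 = s (≡.trans (≡.sym (coeff-var-⊗-raised v P y))
                                        (≡.trans (≡.sym (coeff-cong _ x≗y+eᵥ)) vP[x]≡0))

-- The polytope Q^k_{i,j}

toℕFin≡toℕ : ∀ {n} (m : Fin n) → toℕFin m ≡ toℕ m
toℕFin≡toℕ zero    = ≡.refl
toℕFin≡toℕ (suc m) = cong suc (toℕFin≡toℕ m)

toℕFin<n : ∀ {n} (m : Fin n) → toℕFin m < n
toℕFin<n m = ≡.subst (_< _) (≡.sym (toℕFin≡toℕ m)) (Fin.toℕ<n m)

-- The index v is 0-based: e_v is the exponent of β_{v+1}.
Raise : ∀ {n} → ℕ → ℕ → ((Fin n → ℕ) → Set) → (Fin n → ℕ) → Set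
Raise j k P x = ∃ λ v → j ≤ toℕFin v × toℕFin v < k × ∃ λ y → P y × x ≗ updateAt y v suc

Raise-cong : ∀ {n j k} {P P′ : (Fin n → ℕ) → Set} → (∀ y → P y ⇔ P′ y) →
             ∀ x → Raise j k P x ⇔ Raise j k P′ x
Raise-cong P⇔P′ x = mk⇔
  (λ (v , j≤v , v<k , y , Py , x≗) → v , j≤v , v<k , y , Equivalence.to (P⇔P′ y) Py , x≗)
  (λ (v , j≤v , v<k , y , P′y , x≗) → v , j≤v , v<k , y , Equivalence.from (P⇔P′ y) P′y , x≗)

psum-cong : ∀ {n} {x y : Fin n → ℕ} → x ≗ y → ∀ ℓ → psum x ℓ ≡ psum y ℓ
psum-cong {zero}  _   _       = ≡.refl
psum-cong {suc n} _   zero    = ≡.refl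
psum-cong {suc n} x≗y (suc ℓ) = cong₂ _+_ (x≗y zero) (psum-cong (x≗y ∘ suc) ℓ)

psum-zero : ∀ {n} (x : Fin n → ℕ) → psum x 0 ≡ 0
psum-zero {zero}  x = ≡.refl
psum-zero {suc n} x = ≡.refl

psum-mono : ∀ {n} {x y : Fin n → ℕ} → (∀ m → x m ≤ y m) → ∀ ℓ → psum x ℓ ≤ psum y ℓ
psum-mono {zero}  _   _       = z≤n
psum-mono {suc n} _   zero    = z≤n
psum-mono {suc n} x≤y (suc ℓ) = ℕ.+-mono-≤ (x≤y zero) (psum-mono (x≤y ∘ suc) ℓ)

psum≤total : ∀ {n} (x : Fin n → ℕ) ℓ → psum x ℓ ≤ psum x n
psum≤total {zero}  x ℓ       = z≤n
psum≤total {suc n} x zero    = z≤n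
psum≤total {suc n} x (suc ℓ) = ℕ.+-monoʳ-≤ (x zero) (psum≤total (x ∘ suc) ℓ)

entry≤total : ∀ {n} (x : Fin n → ℕ) m → x m ≤ psum x n
entry≤total x zero    = ℕ.m≤m+n (x zero) _
entry≤total x (suc m) = ℕ.≤-trans (entry≤total (x ∘ suc) m) (ℕ.m≤n+m _ (x zero))

total-vanishing-tail : ∀ {n} (x : Fin n → ℕ) j → (∀ m → j ≤ toℕFin m → x m ≡ 0) → psum x n ≡ psum x j
total-vanishing-tail {zero}  x j       x≡0 = ≡.refl
total-vanishing-tail {suc n} x zero    x≡0 = cong₂ _+_ (x≡0 zero z≤n)
  (≡.trans (total-vanishing-tail (x ∘ suc) zero λ m _ → x≡0 (suc m) z≤n) (psum-zero (x ∘ suc)))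
total-vanishing-tail {suc n} x (suc j) x≡0 =
  cong (x zero +_) (total-vanishing-tail (x ∘ suc) j λ m j≤m → x≡0 (suc m) (s≤s j≤m))

≤-raise : ∀ {n} (y : Fin n → ℕ) v m → y m ≤ updateAt y v suc m
≤-raise y zero    zero    = ℕ.n≤1+n _
≤-raise y zero    (suc m) = ℕ.≤-refl
≤-raise y (suc v) zero    = ℕ.≤-refl
≤-raise y (suc v) (suc m) = ≤-raise (tail y) v m

psum-raise-< : ∀ {n} (y : Fin n → ℕ) v ℓ → toℕFin v < ℓ → psum (updateAt y v suc) ℓ ≡ suc (psum y ℓ)
psum-raise-< y zero    (suc ℓ) _         = ≡.refl
psum-raise-< y (suc v) (suc ℓ) (s≤s v<ℓ) =
  ≡.trans (cong (y zero +_) (psum-raise-< (tail y) v ℓ v<ℓ)) (ℕ.+-suc (y zero) _)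

psum-raise-≥ : ∀ {n} (y : Fin n → ℕ) v ℓ → ℓ ≤ toℕFin v → psum (updateAt y v suc) ℓ ≡ psum y ℓ
psum-raise-≥ {suc n} y v       zero    _         = ≡.refl
psum-raise-≥ y (suc v) (suc ℓ) (s≤s ℓ≤v) = cong (y zero +_) (psum-raise-≥ (tail y) v ℓ ℓ≤v)

-- Lattice points of Q^k_{i,j}, together with the range i, j ≤ k ≤ i + j of nonzero C^k_{i,j};
-- the condition Σ x = i + j − k is stated without truncated subtraction.
module Polytope (n i : ℕ) where

  record InPolytope (j k : ℕ) (x : Fin n → ℕ) : Set where
    field
      i≤k       : i ≤ k
      j≤k       : j ≤ k
      total     : psum x n + k ≡ i + j
      bounded   : ∀ ℓ → ℓ ≤ i → psum x ℓ ≤ ℓ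
      vanishing : ∀ m → k ≤ toℕFin m → x m ≡ 0

    total≤j : psum x n ≤ j
    total≤j = ℕ.+-cancelʳ-≤ k (psum x n) j
      (ℕ.≤-trans (ℕ.≤-reflexive total) (ℕ.≤-trans (ℕ.+-monoˡ-≤ j i≤k) (ℕ.≤-reflexive (ℕ.+-comm k j))))

  InPolytope↓ : ℕ → ℕ → (Fin n → ℕ) → Set
  InPolytope↓ j zero    x = ⊥
  InPolytope↓ j (suc k) x = InPolytope j k x

  InQ⇔InPolytope : ∀ {j k} → i ≤ k → j ≤ k → k ≤ i + j → ∀ x → InQ n i k (i + j ∸ k) x ⇔ InPolytope j k x
  InQ⇔InPolytope {j} {k} i≤k j≤k k≤i+j x = mk⇔
    (λ (total , bounded , vanishing) → record
      { i≤k = i≤k ; j≤k = j≤k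
      ; total = ≡.trans (cong (_+ k) total) (ℕ.m∸n+n≡m k≤i+j)
      ; bounded = λ { zero _ → ℕ.≤-reflexive (psum-zero x) ; (suc ℓ) → bounded (suc ℓ) (s≤s z≤n) }
      ; vanishing = vanishing })
    (λ p → let open InPolytope p in
      ≡.trans (≡.sym (ℕ.m+n∸n≡m (psum x n) k)) (cong (_∸ k) total) , (λ ℓ _ → bounded ℓ) , vanishing)

  InPolytope-zero : ∀ k x → InPolytope 0 k x ⇔ (k ≡ i × ∀ m → x m ≡ 0)
  InPolytope-zero k x = mk⇔ to from
    where
    to : InPolytope 0 k x → k ≡ i × ∀ m → x m ≡ 0
    to p = k≡i , λ m → ℕ.n≤0⇒n≡0 (ℕ.≤-trans (entry≤total x m) total≤j)
      where
      open InPolytope p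
      k≡i = ℕ.≤-antisym
        (ℕ.≤-trans (ℕ.m≤n+m k (psum x n)) (ℕ.≤-reflexive (≡.trans total (ℕ.+-identityʳ i)))) i≤k
    from : k ≡ i × (∀ m → x m ≡ 0) → InPolytope 0 k x
    from (≡.refl , x≡0) = record
      { i≤k = ℕ.≤-refl ; j≤k = z≤n
      ; total = ≡.trans (cong (_+ i) total≡0) (≡.sym (ℕ.+-identityʳ i))
      ; bounded = λ ℓ _ → ℕ.≤-trans (psum≤total x ℓ) (ℕ.≤-trans (ℕ.≤-reflexive total≡0) z≤n)
      ; vanishing = λ m _ → x≡0 m }
      where
      total≡0 : psum x n ≡ 0
      total≡0 = ≡.trans (total-vanishing-tail x 0 λ m _ → x≡0 m) (psum-zero x)

  InPolytope-↓ : ∀ j k x → InPolytope↓ j k x → InPolytope (suc j) k x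
  InPolytope-↓ j (suc k) x p = record
    { i≤k = ℕ.m≤n⇒m≤1+n i≤k ; j≤k = s≤s j≤k
    ; total = ≡.trans (ℕ.+-suc (psum x n) k) (≡.trans (cong suc total) (≡.sym (ℕ.+-suc i j)))
    ; bounded = bounded
    ; vanishing = λ m 1+k≤m → vanishing m (ℕ.m+n≤o⇒n≤o 1 1+k≤m) }
    where open InPolytope p

  InPolytope-raise : ∀ j k x → Raise j k (InPolytope j k) x → InPolytope (suc j) k x
  InPolytope-raise j k x (v , j≤v , v<k , y , p , x≗y+eᵥ) = record
    { i≤k = i≤k ; j≤k = ℕ.≤-<-trans j≤v v<k
    ; total = ≡.trans (cong (_+ k) (psum-x (toℕFin<n v))) (≡.trans (cong suc total) (≡.sym (ℕ.+-suc i j)))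
    ; bounded = bounded′
    ; vanishing = λ m k≤m → ≡.trans (x≗y+eᵥ m)
        (≡.trans (updateAt-minimal m v y λ m≡v → ℕ.<⇒≱ v<k (≡.subst (λ u → k ≤ toℕFin u) m≡v k≤m))
                 (vanishing m k≤m)) }
    where
    open InPolytope p
    psum-x : ∀ {ℓ} → toℕFin v < ℓ → psum x ℓ ≡ suc (psum y ℓ)
    psum-x {ℓ} v<ℓ = ≡.trans (psum-cong x≗y+eᵥ ℓ) (psum-raise-< y v ℓ v<ℓ)
    bounded′ : ∀ ℓ → ℓ ≤ i → psum x ℓ ≤ ℓ
    bounded′ ℓ ℓ≤i with toℕFin v <? ℓ
    ... | yes v<ℓ = ℕ.≤-trans (ℕ.≤-reflexive (psum-x v<ℓ))
                      (ℕ.≤-trans (s≤s (ℕ.≤-trans (psum≤total y ℓ) total≤j)) (ℕ.≤-trans (s≤s j≤v) v<ℓ))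
    ... | no v≮ℓ  = ℕ.≤-trans
                      (ℕ.≤-reflexive (≡.trans (psum-cong x≗y+eᵥ ℓ) (psum-raise-≥ y v ℓ (ℕ.≮⇒≥ v≮ℓ))))
                      (bounded ℓ ℓ≤i)

  -- Either x has a positive entry at some index v ≥ j, which can be lowered, or all its mass
  -- sits below j, and then x already lies in the polytope for (j, k - 1).
  InPolytope-suc-cases : ∀ j k x → InPolytope (suc j) k x → InPolytope↓ j k x ⊎ Raise j k (InPolytope j k) x
  InPolytope-suc-cases j k x p with Fin.any? (λ m → (j ≤? toℕFin m) ×-dec (1 ≤? x m))
  ... | yes (v , j≤v , 1≤xᵥ) with unraise x v
  ...   | inj₁ xᵥ≡0   = ⊥-elim (ℕ.<⇒≱ 1≤xᵥ (ℕ.≤-reflexive xᵥ≡0))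
  ...   | inj₂ x≗y+eᵥ = inj₂ (v , j≤v , v<k , y , p′ , x≗y+eᵥ)
    where
    open InPolytope p
    y = updateAt x v pred
    v<k : toℕFin v < k
    v<k = ℕ.≰⇒> λ k≤v → ℕ.<⇒≱ 1≤xᵥ (ℕ.≤-reflexive (vanishing v k≤v))
    y≤x : ∀ m → y m ≤ x m
    y≤x m = ℕ.≤-trans (≤-raise y v m) (ℕ.≤-reflexive (≡.sym (x≗y+eᵥ m)))
    p′ : InPolytope j k y
    p′ = record
      { i≤k = i≤k ; j≤k = ℕ.≤-trans (ℕ.n≤1+n j) j≤k
      ; total = ℕ.suc-injective (≡.trans (≡.sym (cong (_+ k) (≡.trans (psum-cong x≗y+eᵥ n)
                  (psum-raise-< y v n (toℕFin<n v))))) (≡.trans total (ℕ.+-suc i j)))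
      ; bounded = λ ℓ ℓ≤i → ℕ.≤-trans (psum-mono y≤x ℓ) (bounded ℓ ℓ≤i)
      ; vanishing = λ m k≤m → ℕ.n≤0⇒n≡0 (ℕ.≤-trans (y≤x m) (ℕ.≤-reflexive (vanishing m k≤m))) }
  InPolytope-suc-cases j k x p | no ∄ = inj₁ (lower k i≤k j≤k total)
    where
    open InPolytope p using (i≤k; j≤k; total; bounded)
    x≡0-above-j : ∀ m → j ≤ toℕFin m → x m ≡ 0
    x≡0-above-j m j≤m = ℕ.n<1⇒n≡0 (ℕ.≰⇒> λ 1≤xₘ → ∄ (m , j≤m , 1≤xₘ))
    lower : ∀ k → i ≤ k → suc j ≤ k → psum x n + k ≡ i + suc j → InPolytope↓ j k x
    lower (suc k) i≤1+k (s≤s j≤k) total′ = record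
      { i≤k = i≤k′ ; j≤k = j≤k
      ; total = ℕ.suc-injective (≡.trans (≡.sym (ℕ.+-suc (psum x n) k)) (≡.trans total′ (ℕ.+-suc i j)))
      ; bounded = bounded
      ; vanishing = λ m k≤m → x≡0-above-j m (ℕ.≤-trans j≤k k≤m) }
      where
      -- if i = k + 1, the total mass would be j + 1, yet it is at most j
      i≤k′ : i ≤ k
      i≤k′ with ℕ.m≤n⇒m<n∨m≡n i≤1+k
      ... | inj₁ i<1+k = ℕ.≤-pred i<1+k
      ... | inj₂ ≡.refl = ⊥-elim (ℕ.<⇒≱ (ℕ.≤-reflexive (≡.sym mass≡1+j)) mass≤j)
        where
        mass≡1+j : psum x n ≡ suc j
        mass≡1+j = ℕ.+-cancelʳ-≡ (suc k) (psum x n) (suc j) (≡.trans total′ (ℕ.+-comm (suc k) (suc j)))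
        mass≤j : psum x n ≤ j
        mass≤j = ℕ.≤-trans (ℕ.≤-reflexive (total-vanishing-tail x j x≡0-above-j))
                           (bounded j (ℕ.m≤n⇒m≤1+n j≤k))

  InPolytope-suc : ∀ j k x → InPolytope (suc j) k x ⇔ (InPolytope↓ j k x ⊎ Raise j k (InPolytope j k) x)
  InPolytope-suc j k x = mk⇔ (InPolytope-suc-cases j k x) [ InPolytope-↓ j k x , InPolytope-raise j k x ]

private
  +-<-∸ : ∀ j {d k} → d < k ∸ j → j + d < k
  +-<-∸ j {d} {k} d<k∸j = ≡.subst (_≤ k) (cong suc (ℕ.+-comm d j)) (ℕ.m≤o∸n⇒m+n≤o (suc d) j≤k d<k∸j)
    where j≤k = ℕ.<⇒≤ (ℕ.m∸n≢0⇒n<m λ k∸j≡0 → ℕ.n≮0 (≡.subst (d <_) k∸j≡0 d<k∸j))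

  variable-index : ∀ {n w} → w < n → ∃ λ (v : Fin n) → toℕFin v ≡ w
  variable-index w<n = fromℕ< w<n , ≡.trans (toℕFin≡toℕ (fromℕ< w<n)) (Fin.toℕ-fromℕ< w<n)

module SupportOfC (n i : ℕ) where
  open Cohomology n
  open StructureConstants n i
  open Polytope n i
  open ≈-Reasoning (⇔.⇔-setoid 0ℓ)

  βRange-⊗ : ∀ j k P → βRange (suc j) k ⊗ P ≋ ∑B.∑< (k ∸ j) (λ d → varN (j + d) ⊗ P)
  βRange-⊗ j k P = ∑B.∑<-*ʳ (k ∸ j) (λ d → βP (suc j + d)) P

  module _ (j k : ℕ) {P : Poly n} (k≤n : k ≤ n) (P≥0 : NonNegative P) where

    private
      summand≥0 : ∀ d → d < k ∸ j → NonNegative (varN (j + d) ⊗ P)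
      summand≥0 d d<k∸j with variable-index (ℕ.<-≤-trans (+-<-∸ j d<k∸j) k≤n)
      ... | v , v≡j+d = ≡.subst (λ w → NonNegative (varN w ⊗ P)) v≡j+d (NonNegative-var-⊗ v P≥0)

    NonNegative-βRange-⊗ : NonNegative (βRange (suc j) k ⊗ P)
    NonNegative-βRange-⊗ = NonNegative-≋ (B.sym (βRange-⊗ j k P)) (NonNegative-∑< (k ∸ j) summand≥0)

    Supp-βRange-⊗ : ∀ x → Supp (βRange (suc j) k ⊗ P) x ⇔ Raise j k (Supp P) x
    Supp-βRange-⊗ x = begin
      Supp (βRange (suc j) k ⊗ P) x                        ≈⟨ Supp-≋ (βRange-⊗ j k P) x ⟩
      Supp (∑B.∑< (k ∸ j) (λ d → varN (j + d) ⊗ P)) x      ≈⟨ Supp-∑< (k ∸ j) summand≥0 x ⟩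
      (∃ λ d → d < k ∸ j × Supp (varN (j + d) ⊗ P) x)      ≈⟨ mk⇔ to from ⟩
      Raise j k (Supp P) x                                 ∎
      where
      to : (∃ λ d → d < k ∸ j × Supp (varN (j + d) ⊗ P) x) → Raise j k (Supp P) x
      to (d , d<k∸j , s) with variable-index (ℕ.<-≤-trans (+-<-∸ j d<k∸j) k≤n)
      ... | v , v≡j+d with Equivalence.to (Supp-var-⊗ v P x) (≡.subst (λ w → Supp (varN w ⊗ P) x) (≡.sym v≡j+d) s)
      ...   | y , Py , x≗y+eᵥ = v , ≡.subst (j ≤_) (≡.sym v≡j+d) (ℕ.m≤m+n j d) ,
                                ≡.subst (_< k) (≡.sym v≡j+d) (+-<-∸ j d<k∸j) , y , Py , x≗y+eᵥ
      from : Raise j k (Supp P) x → ∃ λ d → d < k ∸ j × Supp (varN (j + d) ⊗ P) x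
      from (v , j≤v , v<k , y , Py , x≗y+eᵥ) = toℕFin v ∸ j , ℕ.∸-monoˡ-< v<k j≤v ,
        ≡.subst (λ w → Supp (varN w ⊗ P) x) (≡.sym (ℕ.m+[n∸m]≡n j≤v))
          (Equivalence.from (Supp-var-⊗ v P x) (y , Py , x≗y+eᵥ))

  C-support : ∀ j k → k ≤ n → NonNegative (C j k) × (∀ x → Supp (C j k) x ⇔ InPolytope j k x)
  C-support zero k k≤n with k ≟ i
  ... | yes ≡.refl = ≡.subst (λ c → NonNegative c × ∀ x → Supp c x ⇔ InPolytope 0 k x) (≡.sym C₀-diagonal)
    (NonNegative-oneP , λ x → begin
      Supp oneP x                  ≈⟨ Supp-oneP x ⟩
      (∀ m → x m ≡ 0)              ≈⟨ mk⇔ (≡.refl ,_) proj₂ ⟩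
      (k ≡ k × ∀ m → x m ≡ 0)      ≈⟨ InPolytope-zero k x ⟨
      InPolytope 0 k x             ∎)
  ... | no k≢i = ≡.subst (λ c → NonNegative c × ∀ x → Supp c x ⇔ InPolytope 0 k x) (≡.sym (C₀-off-diagonal k≢i))
    (NonNegative-zeroP , λ x →
      mk⇔ (⊥-elim ∘ ¬Supp-zeroP x) (⊥-elim ∘ k≢i ∘ proj₁ ∘ Equivalence.to (InPolytope-zero k x)))
  C-support (suc j) k k≤n = NonNegative-⊕ C↓≥0 L⊗C≥0 , λ x → begin
    Supp (C↓ j k ⊕ βRange (suc j) k ⊗ C j k) x                       ≈⟨ Supp-⊕ C↓≥0 L⊗C≥0 x ⟩
    (Supp (C↓ j k) x ⊎ Supp (βRange (suc j) k ⊗ C j k) x)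
      ≈⟨ proj₂ (C↓-support k k≤n) x ⊎-⇔ Supp-βRange-⊗ j k k≤n C≥0 x ⟩
    (InPolytope↓ j k x ⊎ Raise j k (Supp (C j k)) x)
      ≈⟨ ⇔.refl ⊎-⇔ Raise-cong (proj₂ (C-support j k k≤n)) x ⟩
    (InPolytope↓ j k x ⊎ Raise j k (InPolytope j k) x)               ≈⟨ InPolytope-suc j k x ⟨
    InPolytope (suc j) k x                                           ∎
    where
    C≥0 = proj₁ (C-support j k k≤n)
    L⊗C≥0 = NonNegative-βRange-⊗ j k k≤n C≥0
    C↓-support : ∀ k → k ≤ n → NonNegative (C↓ j k) × (∀ x → Supp (C↓ j k) x ⇔ InPolytope↓ j k x)
    C↓-support zero    _     = NonNegative-zeroP , λ x → mk⇔ (¬Supp-zeroP x) λ ()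
    C↓-support (suc k) 1+k≤n = C-support j k (ℕ.m+n≤o⇒n≤o 1 1+k≤n)
    C↓≥0 = proj₁ (C↓-support k k≤n)

-- Saturation

private
  -- z / 1 in normal form (Defs.toℚ uses the normalising _/_)
  [_/1] : ℤ → ℚ
  [ z /1] = mkℚ z 0 (Coprimality.sym (Coprimality.1-coprimeTo ℤ.∣ z ∣))

  /1≡ : ∀ z → z ℚ./ 1 ≡ [ z /1]
  /1≡ z = ℚ.↥p/↧p≡p [ z /1]

  [/1]-mono-≤ : ∀ {a b} → a ℤ.≤ b → [ a /1] ℚ.≤ [ b /1]
  [/1]-mono-≤ {a} {b} a≤b = ℚ.*≤* (subst₂ ℤ._≤_ (≡.sym (ℤ.*-identityʳ a)) (≡.sym (ℤ.*-identityʳ b)) a≤b)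

  [/1]-cancel-≤ : ∀ {a b} → [ a /1] ℚ.≤ [ b /1] → a ℤ.≤ b
  [/1]-cancel-≤ {a} {b} a≤b = subst₂ ℤ._≤_ (ℤ.*-identityʳ a) (ℤ.*-identityʳ b) (ℚ.drop-*≤* a≤b)

  toℚ-+ : ∀ a b → toℚ (a + b) ≡ toℚ a ℚ.+ toℚ b
  toℚ-+ a b = ≡.trans
    (ℚ./-cong {p₁ = ℤ.+ (a + b)} {q₁ = 1} {q₂ = 1}
      (≡.sym (cong₂ ℤ._+_ (ℤ.*-identityʳ (ℤ.+ a)) (ℤ.*-identityʳ (ℤ.+ b)))) ≡.refl)
    (≡.sym (cong₂ ℚ._+_ (/1≡ (ℤ.+ a)) (/1≡ (ℤ.+ b))))

  toℚ-mono-≤ : ∀ {a b} → a ≤ b → toℚ a ℚ.≤ toℚ b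
  toℚ-mono-≤ {a} {b} a≤b =
    subst₂ ℚ._≤_ (≡.sym (/1≡ (ℤ.+ a))) (≡.sym (/1≡ (ℤ.+ b))) ([/1]-mono-≤ (ℤ.+≤+ a≤b))

  /1-cancel-≤ : ∀ {a b} → a ℚ./ 1 ℚ.≤ b ℚ./ 1 → a ℤ.≤ b
  /1-cancel-≤ {a} {b} a≤b = [/1]-cancel-≤ (subst₂ ℚ._≤_ (/1≡ a) (/1≡ b) a≤b)

  toℚ-cancel-≤ : ∀ {a b} → toℚ a ℚ.≤ toℚ b → a ≤ b
  toℚ-cancel-≤ {a} {b} a≤b = ℤ.drop‿+≤+ (/1-cancel-≤ {ℤ.+ a} {ℤ.+ b} a≤b)

  toℚ-injective : ∀ {a b} → toℚ a ≡ toℚ b → a ≡ b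
  toℚ-injective a≡b =
    ℕ.≤-antisym (toℚ-cancel-≤ (ℚ.≤-reflexive a≡b)) (toℚ-cancel-≤ (ℚ.≤-reflexive (≡.sym a≡b)))

module _ {n : ℕ} where
  open CommSemigroupProperties (CommutativeMonoid.commutativeSemigroup ℚ.+-0-commutativeMonoid)
    using () renaming (interchange to +-interchange)

  Points = List (ℚ × (Fin n → ℕ))

  weight : Points → ℚ
  weight = foldr (λ wy s → proj₁ wy ℚ.+ s) 0ℚ

  -- average ps (λ y → y m) is, definitionally, the m-th coordinate sum in InConvHullSupp
  average : Points → ((Fin n → ℕ) → ℕ) → ℚ
  average ps f = foldr (λ wy s → proj₁ wy ℚ.* toℚ (f (proj₂ wy)) ℚ.+ s) 0ℚ ps

  average-const : ∀ ps c → average ps (λ _ → c) ≡ toℚ c ℚ.* weight ps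
  average-const []             c = ≡.sym (ℚ.*-zeroʳ (toℚ c))
  average-const ((w , y) ∷ ps) c = ≡.trans
    (cong₂ ℚ._+_ (ℚ.*-comm w (toℚ c)) (average-const ps c)) (≡.sym (ℚ.*-distribˡ-+ (toℚ c) w (weight ps)))

  average-cong : ∀ {ps} f g → All (λ wy → f (proj₂ wy) ≡ g (proj₂ wy)) ps → average ps f ≡ average ps g
  average-cong                  f g []               = ≡.refl
  average-cong {(w , _) ∷ _} f g (f≡g ∷ f≡g-rest) =
    cong₂ ℚ._+_ (cong (λ a → w ℚ.* toℚ a) f≡g) (average-cong f g f≡g-rest)

  average-mono : ∀ {ps} f g → All (λ wy → 0ℚ ℚ.≤ proj₁ wy × f (proj₂ wy) ≤ g (proj₂ wy)) ps →
                 average ps f ℚ.≤ average ps g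
  average-mono f g []                                = ℚ.≤-refl
  average-mono {(w , _) ∷ _} f g ((w≥0 , f≤g) ∷ rest) =
    ℚ.+-mono-≤ (ℚ.*-monoˡ-≤-nonNeg w {{ℚ.nonNegative w≥0}} (toℚ-mono-≤ f≤g)) (average-mono f g rest)

  average-+ : ∀ ps f g → average ps (λ y → f y + g y) ≡ average ps f ℚ.+ average ps g
  average-+ []             f g = ≡.sym (ℚ.+-identityˡ 0ℚ)
  average-+ ((w , y) ∷ ps) f g = ≡.trans
    (cong₂ ℚ._+_ (≡.trans (cong (w ℚ.*_) (toℚ-+ (f y) (g y))) (ℚ.*-distribˡ-+ w _ _)) (average-+ ps f g))
    (+-interchange (w ℚ.* toℚ (f y)) (w ℚ.* toℚ (g y)) (average ps f) (average ps g))

  average-psum : ∀ ps {n′} (g : Fin n′ → (Fin n → ℕ) → ℕ) z → (∀ m → average ps (g m) ≡ toℚ (z m)) →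
                 ∀ ℓ → average ps (λ y → psum (λ m → g m y) ℓ) ≡ toℚ (psum z ℓ)
  average-psum ps {zero}   g z _    ℓ       = ≡.trans (average-const ps 0) (ℚ.*-zeroˡ (weight ps))
  average-psum ps {suc n′} g z _    zero    = ≡.trans (average-const ps 0) (ℚ.*-zeroˡ (weight ps))
  average-psum ps {suc n′} g z avg≡ (suc ℓ) = ≡.trans (average-+ ps (g zero) _)
    (≡.trans (cong₂ ℚ._+_ (avg≡ zero) (average-psum ps (g ∘ suc) (z ∘ suc) (avg≡ ∘ suc) ℓ))
             (≡.sym (toℚ-+ (z zero) _)))

-- InQ is cut out by linear equations and inequalities, which survive averaging; the average of
-- lattice points, if integral, is therefore again a point of InQ.
Supp⇔InQ⇒SNP : ∀ {n} {P : Poly n} i k r → (∀ y → Supp P y ⇔ InQ n i k r y) → SNP P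
Supp⇔InQ⇒SNP {n} {P} i k r Supp⇔InQ x (pts , pts-ok , weight≡1 , x≡avg) =
  z , x≡z , Equivalence.from (Supp⇔InQ z) z∈Q
  where
  pts∈Q : All (λ wy → 0ℚ ℚ.≤ proj₁ wy × InQ n i k r (proj₂ wy)) pts
  pts∈Q = All.map (λ (w≥0 , s) → w≥0 , Equivalence.to (Supp⇔InQ _) s) pts-ok
  avg-const : ∀ c → average pts (λ _ → c) ≡ toℚ c
  avg-const c = ≡.trans (average-const pts c) (≡.trans (cong (toℚ c ℚ.*_) weight≡1) (ℚ.*-identityʳ (toℚ c)))
  x≥0 : ∀ m → 0ℤ ℤ.≤ x m
  x≥0 m = /1-cancel-≤ (subst₂ ℚ._≤_ (avg-const 0) (x≡avg m)
    (average-mono (λ _ → 0) (λ y → y m) (All.map (λ (w≥0 , _) → w≥0 , z≤n) pts-ok)))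
  z : Fin n → ℕ
  z m = ℤ.∣ x m ∣
  x≡z : ∀ m → x m ≡ ℤ.+ z m
  x≡z m = ≡.sym (ℤ.0≤i⇒+∣i∣≡i (x≥0 m))
  avg-coord : ∀ m → average pts (λ y → y m) ≡ toℚ (z m)
  avg-coord m = ≡.trans (x≡avg m) (cong (ℚ._/ 1) (x≡z m))
  avg-psum : ∀ ℓ → average pts (λ y → psum y ℓ) ≡ toℚ (psum z ℓ)
  avg-psum = average-psum pts (λ m y → y m) z avg-coord
  z∈Q : InQ n i k r z
  z∈Q = toℚ-injective (≡.trans (≡.sym (avg-psum n))
          (≡.trans (average-cong (λ y → psum y n) (λ _ → r) (All.map (proj₁ ∘ proj₂) pts∈Q)) (avg-const r)))
      , (λ ℓ 1≤ℓ ℓ≤i → toℚ-cancel-≤ (subst₂ ℚ._≤_ (avg-psum ℓ) (avg-const ℓ)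
          (average-mono (λ y → psum y ℓ) (λ _ → ℓ)
            (All.map (λ (w≥0 , _ , bounded , _) → w≥0 , bounded ℓ 1≤ℓ ℓ≤i) pts∈Q))))
      , (λ m k≤m → toℚ-injective (≡.trans (≡.sym (avg-coord m))
          (≡.trans (average-cong (λ y → y m) (λ _ → 0)
                     (All.map (λ (_ , _ , _ , vanishing) → vanishing m k≤m) pts∈Q))
                   (avg-const 0))))

structureConstants-unique : ∀ n i j c → i ≤ n → IsStructConst n i j c →
                            ∀ k → k ≤ n → c k ≋ StructureConstants.C n i j k
structureConstants-unique n i j c i≤n (q , σᵢσⱼ≈) = Uniqueness.expansion-unique n c (C j) q (remainder j)
  (H.trans (H.sym (H.trans (mk≋ σᵢσⱼ≈) (H.+-congʳ {q ⊗ σ n (suc n)} (H.reflexive (expand≡expansion c)))))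
           (σσ-expansion i≤n j))
  where
  open Cohomology n
  open StructureConstants n i

theorem3p1 : (n i j k : ℕ) → 1 ≤ n → i ≤ k → j ≤ k → k ≤ i + j → k ≤ n →
    (c : ℕ → Poly n) → IsStructConst n i j c →
    (∀ x → Supp (c k) x ⇔ InQ n i k (i + j ∸ k) x) × SNP (c k)
theorem3p1 n i j k _ i≤k j≤k k≤i+j k≤n c isStructConst = Supp⇔InQ , Supp⇔InQ⇒SNP i k (i + j ∸ k) Supp⇔InQ
  where
  open StructureConstants n i using (C)
  open SupportOfC n i using (C-support)
  open Polytope n i using (InPolytope; InQ⇔InPolytope)
  open ≈-Reasoning (⇔.⇔-setoid 0ℓ)
  c≋C : c k ≋ C j k
  c≋C = structureConstants-unique n i j c (ℕ.≤-trans i≤k k≤n) isStructConst k k≤n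
  Supp⇔InQ : ∀ x → Supp (c k) x ⇔ InQ n i k (i + j ∸ k) x
  Supp⇔InQ x = begin
    Supp (c k) x                  ≈⟨ Supp-≋ c≋C x ⟩
    Supp (C j k) x                ≈⟨ proj₂ (C-support j k k≤n) x ⟩
    InPolytope j k x              ≈⟨ InQ⇔InPolytope i≤k j≤k k≤i+j x ⟨
    InQ n i k (i + j ∸ k) x       ∎
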